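{- Let $\Gamma\subseteq\mathfrak{S}$ be any set of permutations and let $n\geq1$. Then (a) $A_{\Gamma^{r},n}^{(\mathrm{ides},\mathrm{imaj})}(s,t,q)=t^{n+1}q^{{n \choose 2}}A_{\Gamma,n}^{(\mathrm{ides},\mathrm{imaj})}(s,t^{ -1},q^{ -1})$; (b) $A_{\Gamma^{rc},n}^{(\mathrm{ides},\mathrm{imaj})}(s,t,q)=A_{\Gamma,n}^{(\mathrm{ides},\mathrm{icomaj})}(s,t,q)$; (c) $A_{\Gamma^{rc},n}^{\mathrm{ides}}(s,t)=A_{\Gamma,n}^{\mathrm{ides}}(s,t)$; (d) $A_{\Gamma^{r},n}^{\mathrm{ides}}(s,t)=A_{\Gamma^{c},n}^{\mathrm{ides}}(s,t)=t^{n+1}A_{\Gamma,n}^{\mathrm{ides}}(s,t^{ -1})$; (e) $P_{\Gamma^{c},n}^{\mathrm{ipk}}(s,t)=P_{\Gamma,n}^{\mathrm{ipk}}(s,t)$.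
   Context: $\mathfrak{S}_n$ is the set of permutations of $[n]$ in one-line notation, $\mathfrak{S}=\bigsqcup_n\mathfrak{S}_n$. For $\pi\in\mathfrak{S}_n$: $\pi^r=\pi_n\cdots\pi_1$, $\pi^c=(n+1-\pi_1)\cdots(n+1-\pi_n)$, $\pi^{rc}=(\pi^r)^c$; for $\Gamma\subseteq\mathfrak{S}$, $\Gamma^r=\{\pi^r:\pi\in\Gamma\}$ and similarly $\Gamma^c,\Gamma^{rc}$. $\operatorname{std}$ of a sequence of distinct integers replaces its letters by $1,2,\dots$ in order of size; $\operatorname{occ}_\Gamma(\pi)$ is the number of pairs $(i,\sigma)$ with $\sigma\in\Gamma\cap\mathfrak{S}_m$, $i\in[n-m+1]$ and $\operatorname{std}(\pi_i\cdots\pi_{i+m-1})=\sigma$. A descent of $\pi$ is $i\in[n-1]$ with $\pi_i>\pi_{i+1}$; $\operatorname{des},\operatorname{maj}$ are the number and sum of descents, $\operatorname{comaj}(\pi)=\sum_{i\text{ descent}}(n-i)$; $\operatorname{pk}(\pi)$ is the number of $i\in\{2,\dots,n-1\}$ with $\pi_{i-1}<\pi_i>\pi_{i+1}$; inverse statistics are $\mathrm{ist}(\pi)=\mathrm{st}(\pi^{ -1})$. Define $A_{\Gamma,n}^{(\mathrm{ides},\mathrm{imaj})}(s,t,q)=\sum_{\pi\in\mathfrak{S}_n}s^{\operatorname{occ}_\Gamma(\pi)}t^{\operatorname{ides}(\pi)+1}q^{\operatorname{imaj}(\pi)}$, $A_{\Gamma,n}^{(\mathrm{ides},\mathrm{icomaj})}(s,t,q)=\sum_{\pi\in\mathfrak{S}_n}s^{\operatorname{occ}_\Gamma(\pi)}t^{\operatorname{ides}(\pi)+1}q^{\operatorname{icomaj}(\pi)}$,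 $A_{\Gamma,n}^{\mathrm{ides}}(s,t)=\sum_{\pi\in\mathfrak{S}_n}s^{\operatorname{occ}_\Gamma(\pi)}t^{\operatorname{ides}(\pi)+1}$, $P_{\Gamma,n}^{\mathrm{ipk}}(s,t)=\sum_{\pi\in\mathfrak{S}_n}s^{\operatorname{occ}_\Gamma(\pi)}t^{\operatorname{ipk}(\pi)+1}$. -}

module Defs where

open import Data.Nat using (ℕ; zero; suc; _∸_; _<ᵇ_; _≡ᵇ_) renaming (_+_ to _+ℕ_)
open import Data.Nat.ListAction using (sum)
open import Data.Bool using (Bool; true; false; if_then_else_; _∧_; not)
open import Data.List using (List; []; _∷_; map; filter; length; take; drop; reverse; upTo; concatMap; foldr)
open import Data.Nat.Combinatorics using (_C_)
open import Relation.Nullary.Decidable using (T?)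
open import Algebra.Bundles using (CommutativeRing)
open import Level using (Level)

-- Permutations in one-line notation, as lists of naturals.
-- A set of permutations Γ ⊆ 𝔖 is given by its characteristic function
-- (only its values on permutations, i.e. on outputs of `std`, matter).

PermSet : Set
PermSet = List ℕ → Bool

one-to : ℕ → List ℕ
one-to k = map suc (upTo k)

words : ℕ → ℕ → List (List ℕ)
words zero    n = [] ∷ []
words (suc k) n = concatMap (λ x → map (x ∷_) (words k n)) (one-to n)

elemᵇ : ℕ → List ℕ → Bool
elemᵇ x []       = false
elemᵇ x (y ∷ ys) = if x ≡ᵇ y then true else elemᵇ x ys

distinctᵇ : List ℕ → Bool
distinctᵇ []       = true
distinctᵇ (x ∷ xs) = not (elemᵇ x xs) ∧ distinctᵇ xs

perms : ℕ → List (List ℕ)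
perms n = filter (λ w → T? (distinctᵇ w)) (words n n)

-- 1-based lookup (default 0)
nth : List ℕ → ℕ → ℕ
nth []       _             = 0
nth (x ∷ xs) zero          = 0
nth (x ∷ xs) (suc zero)    = x
nth (x ∷ xs) (suc (suc i)) = nth xs (suc i)

-- 0-based position of j in a word
indexOf : ℕ → List ℕ → ℕ
indexOf j []       = 0
indexOf j (x ∷ xs) = if x ≡ᵇ j then 0 else suc (indexOf j xs)

inverse : List ℕ → List ℕ
inverse π = map (λ j → suc (indexOf j π)) (one-to (length π))

rev : List ℕ → List ℕ
rev = reverse

compl : List ℕ → List ℕ
compl π = map (λ x → suc (length π) ∸ x) π

-- Γ^r, Γ^c, Γ^{rc}  (σ ∈ Γ^r ⟺ σ^r ∈ Γ, etc., since r, c are involutions)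
_ʳ : PermSet → PermSet
(Γ ʳ) σ = Γ (rev σ)

_ᶜ : PermSet → PermSet
(Γ ᶜ) σ = Γ (compl σ)

_ʳᶜ : PermSet → PermSet
(Γ ʳᶜ) σ = Γ (rev (compl σ))

std : List ℕ → List ℕ
std w = map (λ x → suc (length (filter (λ y → T? (y <ᵇ x)) w))) w

-- occ_Γ(π): number of pairs (i, σ), σ ∈ Γ ∩ 𝔖_m, i ∈ [n-m+1],
-- with std(π_i ⋯ π_{i+m-1}) = σ  (m ranges over 0..n; i is 0-based here)
occ : PermSet → List ℕ → ℕ
occ Γ π = sum (map (λ m → length (filter (λ i → T? (Γ (std (take m (drop i π)))))
                                          (upTo (suc (length π ∸ m)))))
                   (upTo (suc (length π))))

descents : List ℕ → List ℕ
descents π = filter (λ i → T? (nth π (suc i) <ᵇ nth π i)) (one-to (length π ∸ 1))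

des maj comaj pk : List ℕ → ℕ
des π   = length (descents π)
maj π   = sum (descents π)
comaj π = sum (map (λ i → length π ∸ i) (descents π))
pk π    = length (filter (λ i → T? ((nth π i <ᵇ nth π (suc i)) ∧ (nth π (suc (suc i)) <ᵇ nth π (suc i))))
                         (one-to (length π ∸ 2)))

ides imaj icomaj ipk : List ℕ → ℕ
ides π   = des (inverse π)
imaj π   = maj (inverse π)
icomaj π = comaj (inverse π)
ipk π    = pk (inverse π)

-- Generating functions, evaluated in an arbitrary commutative ring
-- (a polynomial identity holds iff it holds under every evaluation in
-- every commutative ring; t⁻¹, q⁻¹ are handled by explicit inverses).

module GF {c ℓ : Level} (R : CommutativeRing c ℓ) where
  open CommutativeRing R

  pow : Carrier → ℕ → Carrier
  pow x zero    = 1#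
  pow x (suc k) = x * pow x k

  Σ : List (List ℕ) → (List ℕ → Carrier) → Carrier
  Σ xs f = foldr (λ π acc → f π + acc) 0# xs

  A-ides-imaj : PermSet → ℕ → Carrier → Carrier → Carrier → Carrier
  A-ides-imaj Γ n s t q =
    Σ (perms n) (λ π → pow s (occ Γ π) * pow t (ides π +ℕ 1) * pow q (imaj π))

  A-ides-icomaj : PermSet → ℕ → Carrier → Carrier → Carrier → Carrier
  A-ides-icomaj Γ n s t q =
    Σ (perms n) (λ π → pow s (occ Γ π) * pow t (ides π +ℕ 1) * pow q (icomaj π))

  A-ides : PermSet → ℕ → Carrier → Carrier → Carrier
  A-ides Γ n s t = Σ (perms n) (λ π → pow s (occ Γ π) * pow t (ides π +ℕ 1))

  P-ipk : PermSet → ℕ → Carrier → Carrier → Carrier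
  P-ipk Γ n s t = Σ (perms n) (λ π → pow s (occ Γ π) * pow t (ipk π +ℕ 1))

-- Each identity is a change of variables π ↦ π^r, π^c or π^{rc} in the sum over 𝔖_n.
-- Consecutive-pattern counts move along with it, since standardisation commutes with reversal and
-- complementation: occ_{Γ^r}(π^r) = occ_Γ(π), and likewise for c and rc.  Inversion exchanges the two
-- symmetries, (π^r)⁻¹ = (π⁻¹)^c and (π^c)⁻¹ = (π⁻¹)^r, and the inverse of a permutation never repeats
-- a letter at adjacent positions.  For such a word τ of length n, complementation turns its descents
-- into exactly its ascents and reversal also moves position i to n − i, so
-- des τ + des τ^c = des τ + des τ^r = n − 1, maj τ + maj τ^c = C(n,2), des τ^{rc} = des τ,
-- maj τ^{rc} = comaj τ and pk τ^r = pk τ.  In (a) and (d) the exponents a of t (and of q) thus satisfy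
-- a + b = n + 1 (resp. C(n,2)) with b the exponent for π, so t^a = t^{n+1} (t⁻¹)^b.

module Submission where

open import Defs
open import Data.Nat using (ℕ; _≤_) renaming (_+_ to _+ℕ_)
open import Data.Nat.Combinatorics using (_C_)
open import Data.Product using (_×_)
open import Algebra.Bundles using (CommutativeRing)

open import Data.Nat using (zero; suc; _∸_; _<_; _<ᵇ_; _≡ᵇ_; z≤n; s≤s; _≟_)
import Data.Nat.Properties as ℕ
open import Data.Nat.Tactic.RingSolver using (solve-∀)
open import Data.Nat.Combinatorics using (nCk+nC[k+1]≡[n+1]C[k+1]; nC1≡n)
open import Data.Nat.ListAction using (sum)
open import Data.Nat.ListAction.Properties using (sum-++; sum-↭)
open import Data.Bool using (Bool; true; false; not; _∧_; if_then_else_; T)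
open import Data.Bool.Properties using (⇔→≡; not-involutive; ∧-comm; T-≡)
open import Data.Unit using (tt)
open import Data.Empty using (⊥-elim)
open import Data.Product using (_,_; proj₂)
open import Data.Sum using (inj₁; inj₂)
open import Data.List using (List; []; _∷_; _++_; [_]; map; filter; length; reverse; take; drop; upTo; applyUpTo; concatMap; foldr)
import Data.List.Properties as List
open import Data.List.Relation.Unary.All as All using (All; []; _∷_)
import Data.List.Relation.Unary.All.Properties as All
open import Data.List.Relation.Unary.Any using (here; there)
import Data.List.Relation.Unary.Any as Any
import Data.List.Relation.Unary.Any.Properties as Any
open import Data.List.Relation.Unary.AllPairs using ([]; _∷_)
open import Data.List.Relation.Unary.Unique.Propositional using (Unique)
import Data.List.Relation.Unary.Unique.Propositional.Properties as Unique
open import Data.List.Membership.Propositional using (_∈_; _∉_)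
open import Data.List.Membership.Propositional.Properties using (∈-filter⁺)
open import Data.List.Membership.DecPropositional _≟_ using (_∈?_)
open import Data.List.Relation.Binary.Permutation.Propositional
  using (_↭_; ↭-sym; ↭-refl; ↭-prep; ↭-trans; ↭⇒↭ₛ; module PermutationReasoning)
import Data.List.Relation.Binary.Permutation.Propositional.Properties as ↭
open import Data.List.Relation.Binary.Permutation.Setoid.Properties using (Unique-resp-↭)
open import Relation.Binary.PropositionalEquality hiding ([_])
open import Relation.Binary.Definitions using (tri<; tri≈; tri>)
open import Relation.Nullary using (¬_; yes; no; ¬?)
open import Relation.Nullary.Decidable using (T?)
open import Function using (_∘_; id; case_of_; mk⇔; Equivalence)
import Algebra.Properties.CommutativeSemigroup as CommSemigroup
import Relation.Binary.Reasoning.Setoid as SetoidReasoning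

range : ℕ → ℕ → List ℕ
range a zero    = []
range a (suc k) = a ∷ range (suc a) k

applyUpTo≡range : ∀ n (f : ℕ → ℕ) a → (∀ i → f i ≡ a +ℕ i) → applyUpTo f n ≡ range a n
applyUpTo≡range zero    f a f≗a+ = refl
applyUpTo≡range (suc n) f a f≗a+ =
  cong₂ _∷_ (trans (f≗a+ 0) (ℕ.+-identityʳ a))
            (applyUpTo≡range n (f ∘ suc) (suc a) (λ i → trans (f≗a+ (suc i)) (ℕ.+-suc a i)))

upTo≡range : ∀ n → upTo n ≡ range 0 n
upTo≡range n = applyUpTo≡range n id 0 (λ _ → refl)

one-to≡range : ∀ n → one-to n ≡ range 1 n
one-to≡range n = trans (List.map-applyUpTo id suc n) (applyUpTo≡range n suc 1 (λ _ → refl))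

length-range : ∀ a k → length (range a k) ≡ k
length-range a zero    = refl
length-range a (suc k) = cong suc (length-range (suc a) k)

range-snoc : ∀ a k → range a (suc k) ≡ range a k ++ [ a +ℕ k ]
range-snoc a zero    = cong [_] (sym (ℕ.+-identityʳ a))
range-snoc a (suc k) = cong (a ∷_) (trans (range-snoc (suc a) k) (cong (λ z → range (suc a) k ++ [ z ]) (sym (ℕ.+-suc a k))))

∈-range⁺ : ∀ {x} a k → a ≤ x → x < a +ℕ k → x ∈ range a k
∈-range⁺ {x} a zero    a≤x x<a+0 = ⊥-elim (ℕ.<⇒≱ x<a+0 (subst (_≤ x) (sym (ℕ.+-identityʳ a)) a≤x))
∈-range⁺ {x} a (suc k) a≤x x<a+k with ℕ.m≤n⇒m<n∨m≡n a≤x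
... | inj₂ refl = here refl
... | inj₁ a<x  = there (∈-range⁺ (suc a) k a<x (subst (x <_) (ℕ.+-suc a k) x<a+k))

All-range : ∀ {p} {P : ℕ → Set p} a k → (∀ x → a ≤ x → x < a +ℕ k → P x) → All P (range a k)
All-range a zero    h = []
All-range a (suc k) h =
  h a ℕ.≤-refl (ℕ.m<m+n a (s≤s z≤n))
  ∷ All-range (suc a) k (λ x a<x x<a+k → h x (ℕ.<⇒≤ a<x) (subst (x <_) (sym (ℕ.+-suc a k)) x<a+k))

map-reflect-range : ∀ k a s → a +ℕ (a +ℕ k) ≡ suc s → map (s ∸_) (range a k) ≡ reverse (range a k)
map-reflect-range zero          a s _ = refl
map-reflect-range (suc zero)    a s e =
  cong [_] (trans (cong (_∸ a) (ℕ.suc-injective (trans (sym e) (2a+1 a)))) (ℕ.m+n∸m≡n a a))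
  where
  2a+1 : ∀ a → a +ℕ (a +ℕ 1) ≡ suc (a +ℕ a)
  2a+1 = solve-∀
map-reflect-range (suc (suc k)) a s e = begin
    map (s ∸_) (a ∷ range (suc a) (suc k))
  ≡⟨ cong (λ z → map (s ∸_) (a ∷ z)) (range-snoc (suc a) k) ⟩
    (s ∸ a) ∷ map (s ∸_) (range (suc a) k ++ [ b ])
  ≡⟨ cong ((s ∸ a) ∷_) (List.map-++ (s ∸_) (range (suc a) k) [ b ]) ⟩
    (s ∸ a) ∷ (map (s ∸_) (range (suc a) k) ++ [ s ∸ b ])
  ≡⟨ cong₂ (λ u v → u ∷ (v ++ [ s ∸ b ])) s∸a≡b (map-reflect-range k (suc a) s (trans (inner a k) e)) ⟩
    b ∷ (reverse (range (suc a) k) ++ [ s ∸ b ])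
  ≡⟨ cong (λ u → b ∷ (reverse (range (suc a) k) ++ [ u ])) s∸b≡a ⟩
    (b ∷ reverse (range (suc a) k)) ++ [ a ]
  ≡⟨ cong (_++ [ a ]) (sym (List.reverse-++ (range (suc a) k) [ b ])) ⟩
    reverse (range (suc a) k ++ [ b ]) ++ [ a ]
  ≡⟨ cong (λ z → reverse z ++ [ a ]) (sym (range-snoc (suc a) k)) ⟩
    reverse (range (suc a) (suc k)) ++ [ a ]
  ≡⟨ sym (List.unfold-reverse a (range (suc a) (suc k))) ⟩
    reverse (a ∷ range (suc a) (suc k))
  ∎
  where
  open ≡-Reasoning
  b = suc a +ℕ k
  outer : ∀ a k → a +ℕ (a +ℕ suc (suc k)) ≡ suc (a +ℕ (suc a +ℕ k))
  outer = solve-∀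
  inner : ∀ a k → suc a +ℕ (suc a +ℕ k) ≡ a +ℕ (a +ℕ suc (suc k))
  inner = solve-∀
  s≡a+b : s ≡ a +ℕ b
  s≡a+b = ℕ.suc-injective (trans (sym e) (outer a k))
  s∸a≡b : s ∸ a ≡ b
  s∸a≡b = trans (cong (_∸ a) s≡a+b) (ℕ.m+n∸m≡n a b)
  s∸b≡a : s ∸ b ≡ a
  s∸b≡a = trans (cong (_∸ b) s≡a+b) (ℕ.m+n∸n≡m a b)

filterᵇ : {A : Set} → (A → Bool) → List A → List A
filterᵇ b = filter (λ x → T? (b x))

filterᵇ-map : ∀ {A B : Set} (b : B → Bool) (f : A → B) xs → filterᵇ b (map f xs) ≡ map f (filterᵇ (b ∘ f) xs)
filterᵇ-map b f []       = refl
filterᵇ-map b f (x ∷ xs) with b (f x)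
... | true  = cong (f x ∷_) (filterᵇ-map b f xs)
... | false = filterᵇ-map b f xs

filterᵇ-cong : ∀ {A : Set} {b b′ : A → Bool} {xs} → All (λ x → b x ≡ b′ x) xs → filterᵇ b xs ≡ filterᵇ b′ xs
filterᵇ-cong {xs = []}           []       = refl
filterᵇ-cong {b = b} {b′} {x ∷ xs} (e ∷ es) with b x | b′ x
... | true  | true  = cong (x ∷_) (filterᵇ-cong es)
... | false | false = filterᵇ-cong es
... | true  | false = case e of λ ()
... | false | true  = case e of λ ()

filterᵇ-partition : ∀ {A : Set} (b : A → Bool) xs → filterᵇ b xs ++ filterᵇ (not ∘ b) xs ↭ xs
filterᵇ-partition b []       = ↭-refl
filterᵇ-partition b (x ∷ xs) with b x
... | true  = ↭-prep x (filterᵇ-partition b xs)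
... | false = ↭-trans (↭.shift x (filterᵇ b xs) (filterᵇ (not ∘ b) xs)) (↭-prep x (filterᵇ-partition b xs))

All-reverse : ∀ {p} {A : Set} {P : A → Set p} {xs} → All P xs → All P (reverse xs)
All-reverse pxs = All.tabulate (λ x∈rev → All.lookup pxs (Any.reverse⁻ x∈rev))

filterᵇ-reflect-range : ∀ k a s → a +ℕ (a +ℕ k) ≡ suc s → ∀ b →
                        filterᵇ (b ∘ (s ∸_)) (range a k) ↭ map (s ∸_) (filterᵇ b (range a k))
filterᵇ-reflect-range k a s e b = begin
    filterᵇ (b ∘ f) X
  ≡⟨ cong (filterᵇ (b ∘ f)) (sym f[revX]≡X) ⟩
    filterᵇ (b ∘ f) (map f (reverse X))
  ≡⟨ filterᵇ-map (b ∘ f) f (reverse X) ⟩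
    map f (filterᵇ (b ∘ f ∘ f) (reverse X))
  ≡⟨ cong (map f) (filterᵇ-cong (All-reverse (All-range a k ff≗id))) ⟩
    map f (filterᵇ b (reverse X))
  ↭⟨ ↭.map⁺ f (↭.filter-↭ (λ x → T? (b x)) (↭.↭-reverse X)) ⟩
    map f (filterᵇ b X)
  ∎
  where
  open PermutationReasoning
  f = s ∸_
  X = range a k
  f[revX]≡X : map f (reverse X) ≡ X
  f[revX]≡X = trans (List.reverse-map f X) (trans (cong reverse (map-reflect-range k a s e)) (List.reverse-involutive X))
  ff≗id : ∀ x → a ≤ x → x < a +ℕ k → b (f (f x)) ≡ b x
  ff≗id x _ x<a+k =
    cong b (ℕ.m∸[m∸n]≡n (ℕ.<⇒≤pred (ℕ.<-≤-trans x<a+k (subst (a +ℕ k ≤_) e (ℕ.m≤n+m (a +ℕ k) a)))))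

length-filterᵇ-reflect-range : ∀ k a s → a +ℕ (a +ℕ k) ≡ suc s → ∀ b →
                               length (filterᵇ (b ∘ (s ∸_)) (range a k)) ≡ length (filterᵇ b (range a k))
length-filterᵇ-reflect-range k a s e b =
  trans (↭.↭-length (filterᵇ-reflect-range k a s e b)) (List.length-map (s ∸_) (filterᵇ b (range a k)))

T⇒≡true : ∀ {b} → T b → b ≡ true
T⇒≡true = Equivalence.to T-≡

≡ᵇ⇒≡ : ∀ {x y} → (x ≡ᵇ y) ≡ true → x ≡ y
≡ᵇ⇒≡ {x} {y} e = ℕ.≡ᵇ⇒≡ x y (subst T (sym e) tt)

≡ᵇ-refl : ∀ x → (x ≡ᵇ x) ≡ true
≡ᵇ-refl x = T⇒≡true (ℕ.≡⇒≡ᵇ x x refl)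

≡⇒≡ᵇ : ∀ {x y} → x ≡ y → (x ≡ᵇ y) ≡ true
≡⇒≡ᵇ {x} refl = ≡ᵇ-refl x

≡ᵇ≡false⇒≢ : ∀ {x y} → (x ≡ᵇ y) ≡ false → x ≢ y
≡ᵇ≡false⇒≢ {x} e refl = case trans (sym (≡ᵇ-refl x)) e of λ ()

<ᵇ⇒< : ∀ {a b} → (a <ᵇ b) ≡ true → a < b
<ᵇ⇒< {a} {b} e = ℕ.<ᵇ⇒< a b (subst T (sym e) tt)

<⇒<ᵇ : ∀ {a b} → a < b → (a <ᵇ b) ≡ true
<⇒<ᵇ a<b = T⇒≡true (ℕ.<⇒<ᵇ a<b)

≮⇒<ᵇ≡false : ∀ {a b} → ¬ a < b → (a <ᵇ b) ≡ false
≮⇒<ᵇ≡false {a} {b} a≮b with a <ᵇ b in e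
... | true  = ⊥-elim (a≮b (<ᵇ⇒< e))
... | false = refl

<ᵇ-irrefl : ∀ x → (x <ᵇ x) ≡ false
<ᵇ-irrefl x = ≮⇒<ᵇ≡false {x} {x} (ℕ.<-irrefl refl)

<ᵇ-flip : ∀ {a b} → a ≢ b → (a <ᵇ b) ≡ not (b <ᵇ a)
<ᵇ-flip {a} {b} a≢b with ℕ.<-cmp a b
... | tri< a<b _ b≮a = trans (<⇒<ᵇ a<b) (cong not (sym (≮⇒<ᵇ≡false b≮a)))
... | tri≈ _ a≡b _   = ⊥-elim (a≢b a≡b)
... | tri> a≮b _ b<a = trans (≮⇒<ᵇ≡false a≮b) (cong not (sym (<⇒<ᵇ b<a)))

elemᵇ⇒∈ : ∀ x xs → elemᵇ x xs ≡ true → x ∈ xs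
elemᵇ⇒∈ x (y ∷ ys) e with x ≡ᵇ y in x≡ᵇy
... | true  = here (≡ᵇ⇒≡ x≡ᵇy)
... | false = there (elemᵇ⇒∈ x ys e)

∈⇒elemᵇ : ∀ {x xs} → x ∈ xs → elemᵇ x xs ≡ true
∈⇒elemᵇ {x} (here refl) rewrite ≡ᵇ-refl x = refl
∈⇒elemᵇ {x} (there {x = y} x∈ys) with x ≡ᵇ y
... | true  = refl
... | false = ∈⇒elemᵇ x∈ys

distinctᵇ⇒Unique : ∀ xs → distinctᵇ xs ≡ true → Unique xs
distinctᵇ⇒Unique []       _ = []
distinctᵇ⇒Unique (x ∷ xs) e with elemᵇ x xs in x∈ᵇxs | distinctᵇ xs in dxs
... | false | true  = All.tabulate (λ y∈xs x≡y → x∉xs (subst (_∈ xs) (sym x≡y) y∈xs)) ∷ distinctᵇ⇒Unique xs dxs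
  where
  x∉xs : x ∉ xs
  x∉xs x∈xs = case trans (sym (∈⇒elemᵇ x∈xs)) x∈ᵇxs of λ ()
... | false | false = case e of λ ()
... | true  | _     = case e of λ ()

Unique⇒distinctᵇ : ∀ xs → Unique xs → distinctᵇ xs ≡ true
Unique⇒distinctᵇ []       []               = refl
Unique⇒distinctᵇ (x ∷ xs) (x∉xs ∷ uniq) with elemᵇ x xs in x∈ᵇxs
... | true  = ⊥-elim (All.lookup x∉xs (elemᵇ⇒∈ x xs x∈ᵇxs) refl)
... | false = Unique⇒distinctᵇ xs uniq

distinctᵇ-≡ : ∀ {xs ys} → (Unique xs → Unique ys) → (Unique ys → Unique xs) → distinctᵇ xs ≡ distinctᵇ ys
distinctᵇ-≡ {xs} {ys} to from = ⇔→≡ {z = true} (mk⇔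
  (λ e → Unique⇒distinctᵇ ys (to (distinctᵇ⇒Unique xs e)))
  (λ e → Unique⇒distinctᵇ xs (from (distinctᵇ⇒Unique ys e))))

Unique-reverse : ∀ {xs : List ℕ} → Unique xs → Unique (reverse xs)
Unique-reverse {xs} = Unique-resp-↭ (setoid ℕ) (↭⇒↭ₛ (↭-sym (↭.↭-reverse xs)))

distinctᵇ-reverse : ∀ w → distinctᵇ (reverse w) ≡ distinctᵇ w
distinctᵇ-reverse w =
  distinctᵇ-≡ (subst Unique (List.reverse-involutive w) ∘ Unique-reverse) Unique-reverse

reflect-injective : ∀ {N a b} → a ≤ N → b ≤ N → suc N ∸ a ≡ suc N ∸ b → a ≡ b
reflect-injective a≤N b≤N = ℕ.∸-cancelˡ-≡ (ℕ.m≤n⇒m≤1+n a≤N) (ℕ.m≤n⇒m≤1+n b≤N)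

Unique-map-reflect : ∀ N {xs} → All (_≤ N) xs → Unique xs → Unique (map (suc N ∸_) xs)
Unique-map-reflect N []           []              = []
Unique-map-reflect N {x ∷ _} (x≤N ∷ xs≤N) (x∉xs ∷ uniq) = separated xs≤N x∉xs ∷ Unique-map-reflect N xs≤N uniq
  where
  separated : ∀ {ys} → All (_≤ N) ys → All (x ≢_) ys → All (suc N ∸ x ≢_) (map (suc N ∸_) ys)
  separated []           []           = []
  separated (y≤N ∷ ys≤N) (x≢y ∷ x≢ys) = (x≢y ∘ reflect-injective x≤N y≤N) ∷ separated ys≤N x≢ys

distinctᵇ-map-reflect : ∀ N w → All (_≤ N) w → distinctᵇ (map (suc N ∸_) w) ≡ distinctᵇ w
distinctᵇ-map-reflect N w w≤N = distinctᵇ-≡ Unique.map⁻ (Unique-map-reflect N w≤N)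

indexOf<length : ∀ {j} xs → j ∈ xs → indexOf j xs < length xs
indexOf<length {j} (x ∷ xs) j∈ with x ≡ᵇ j in x≡ᵇj | j∈
... | true  | _          = s≤s z≤n
... | false | here refl  = ⊥-elim (≡ᵇ≡false⇒≢ {j} x≡ᵇj refl)
... | false | there j∈xs = s≤s (indexOf<length xs j∈xs)

nth-indexOf : ∀ {j} xs → j ∈ xs → nth xs (suc (indexOf j xs)) ≡ j
nth-indexOf {j} (x ∷ xs) j∈ with x ≡ᵇ j in x≡ᵇj | j∈
... | true  | _          = ≡ᵇ⇒≡ x≡ᵇj
... | false | here refl  = ⊥-elim (≡ᵇ≡false⇒≢ {j} x≡ᵇj refl)
... | false | there j∈xs = nth-indexOf xs j∈xs

indexOf-++ˡ : ∀ {j} ys zs → j ∈ ys → indexOf j (ys ++ zs) ≡ indexOf j ys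
indexOf-++ˡ {j} (y ∷ ys) zs j∈ with y ≡ᵇ j in y≡ᵇj | j∈
... | true  | _          = refl
... | false | here refl  = ⊥-elim (≡ᵇ≡false⇒≢ {j} y≡ᵇj refl)
... | false | there j∈ys = cong suc (indexOf-++ˡ ys zs j∈ys)

indexOf-++ʳ : ∀ {j} ys zs → j ∉ ys → indexOf j (ys ++ zs) ≡ length ys +ℕ indexOf j zs
indexOf-++ʳ     []       zs j∉     = refl
indexOf-++ʳ {j} (y ∷ ys) zs j∉y∷ys with y ≡ᵇ j in y≡ᵇj
... | true  = ⊥-elim (j∉y∷ys (here (sym (≡ᵇ⇒≡ y≡ᵇj))))
... | false = cong suc (indexOf-++ʳ ys zs (j∉y∷ys ∘ there))

indexOf-reverse : ∀ {j} xs → Unique xs → j ∈ xs → indexOf j (reverse xs) +ℕ suc (indexOf j xs) ≡ length xs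
indexOf-reverse {j} (x ∷ xs) (x∉xs ∷ uniq) j∈ rewrite List.unfold-reverse x xs with x ≡ᵇ j in x≡ᵇj | j∈
... | true  | _          = begin
      indexOf j (reverse xs ++ [ x ]) +ℕ 1
    ≡⟨ cong (_+ℕ 1) (indexOf-++ʳ (reverse xs) [ x ] j∉rev) ⟩
      length (reverse xs) +ℕ indexOf j [ x ] +ℕ 1
    ≡⟨ cong (λ z → length (reverse xs) +ℕ z +ℕ 1) indexOf-j[x]≡0 ⟩
      length (reverse xs) +ℕ 0 +ℕ 1
    ≡⟨ cong (λ z → z +ℕ 0 +ℕ 1) (List.length-reverse xs) ⟩
      length xs +ℕ 0 +ℕ 1
    ≡⟨ ℕ.+-comm (length xs +ℕ 0) 1 ⟩
      suc (length xs +ℕ 0)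
    ≡⟨ cong suc (ℕ.+-identityʳ (length xs)) ⟩
      suc (length xs)
    ∎
  where
  open ≡-Reasoning
  j∉rev : j ∉ reverse xs
  j∉rev j∈rev = All.lookup x∉xs (Any.reverse⁻ j∈rev) (≡ᵇ⇒≡ x≡ᵇj)
  indexOf-j[x]≡0 : indexOf j [ x ] ≡ 0
  indexOf-j[x]≡0 rewrite x≡ᵇj = refl
... | false | here refl  = ⊥-elim (≡ᵇ≡false⇒≢ {j} x≡ᵇj refl)
... | false | there j∈xs =
  trans (cong (_+ℕ suc (suc (indexOf j xs))) (indexOf-++ˡ (reverse xs) [ x ] (Any.reverse⁺ j∈xs)))
        (trans (ℕ.+-suc _ _) (cong suc (indexOf-reverse xs uniq j∈xs)))

indexOf-map : ∀ (f : ℕ → ℕ) j j′ xs → All (λ x → (f x ≡ᵇ j) ≡ (x ≡ᵇ j′)) xs →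
              indexOf j (map f xs) ≡ indexOf j′ xs
indexOf-map f j j′ []       []       = refl
indexOf-map f j j′ (x ∷ xs) (e ∷ es) rewrite e = cong (λ z → if x ≡ᵇ j′ then 0 else suc z) (indexOf-map f j j′ xs es)

nth-map : ∀ (f : ℕ → ℕ) xs i → i < length xs → nth (map f xs) (suc i) ≡ f (nth xs (suc i))
nth-map f (x ∷ xs) zero    _       = refl
nth-map f (x ∷ xs) (suc i) (s≤s i<) = nth-map f xs i i<

nth-range : ∀ a k i → i < k → nth (range a k) (suc i) ≡ a +ℕ i
nth-range a (suc k) zero    _        = sym (ℕ.+-identityʳ a)
nth-range a (suc k) (suc i) (s≤s i<k) = trans (nth-range (suc a) k i i<k) (sym (ℕ.+-suc a i))

All-nth : ∀ {p} {P : ℕ → Set p} xs i → All P xs → i < length xs → P (nth xs (suc i))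
All-nth (x ∷ xs) zero    (px ∷ _)   _        = px
All-nth (x ∷ xs) (suc i) (_  ∷ pxs) (s≤s i<) = All-nth xs i pxs i<

nth-++ˡ : ∀ ys zs i → i < length ys → nth (ys ++ zs) (suc i) ≡ nth ys (suc i)
nth-++ˡ (y ∷ ys) zs zero    _        = refl
nth-++ˡ (y ∷ ys) zs (suc i) (s≤s i<) = nth-++ˡ ys zs i i<

nth-snoc : ∀ ys z → nth (ys ++ [ z ]) (suc (length ys)) ≡ z
nth-snoc []       z = refl
nth-snoc (y ∷ ys) z = nth-snoc ys z

suc[n∸suc-j] : ∀ n j → j < n → suc (n ∸ suc j) ≡ n ∸ j
suc[n∸suc-j] n j j<n = sym (ℕ.+-∸-assoc 1 j<n)

nth-reverse : ∀ xs i → i < length xs → nth (reverse xs) (suc i) ≡ nth xs (length xs ∸ i)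
nth-reverse (x ∷ xs) i i<1+L rewrite List.unfold-reverse x xs with ℕ.m≤n⇒m<n∨m≡n (ℕ.≤-pred i<1+L)
... | inj₁ i<L = begin
      nth (reverse xs ++ [ x ]) (suc i)
    ≡⟨ nth-++ˡ (reverse xs) [ x ] i (subst (i <_) (sym (List.length-reverse xs)) i<L) ⟩
      nth (reverse xs) (suc i)
    ≡⟨ nth-reverse xs i i<L ⟩
      nth xs (length xs ∸ i)
    ≡⟨ cong (nth xs) (sym (suc[n∸suc-j] (length xs) i i<L)) ⟩
      nth (x ∷ xs) (suc (suc (length xs ∸ suc i)))
    ≡⟨ cong (λ z → nth (x ∷ xs) (suc z)) (suc[n∸suc-j] (length xs) i i<L) ⟩
      nth (x ∷ xs) (suc (length xs ∸ i))
    ≡⟨ cong (nth (x ∷ xs)) (sym (ℕ.+-∸-assoc 1 (ℕ.<⇒≤ i<L))) ⟩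
      nth (x ∷ xs) (suc (length xs) ∸ i)
    ∎
  where open ≡-Reasoning
... | inj₂ refl = begin
      nth (reverse xs ++ [ x ]) (suc (length xs))
    ≡⟨ cong (λ z → nth (reverse xs ++ [ x ]) (suc z)) (sym (List.length-reverse xs)) ⟩
      nth (reverse xs ++ [ x ]) (suc (length (reverse xs)))
    ≡⟨ nth-snoc (reverse xs) x ⟩
      x
    ≡⟨ cong (nth (x ∷ xs)) (sym (ℕ.m+n∸n≡m 1 (length xs))) ⟩
      nth (x ∷ xs) (suc (length xs) ∸ length xs)
    ∎
  where open ≡-Reasoning

-- Permutations as words

Letter : ℕ → ℕ → Set
Letter N x = 1 ≤ x × x ≤ N

IsPerm : List ℕ → Set
IsPerm π = Unique π × All (Letter (length π)) π

length-one-to : ∀ N → length (one-to N) ≡ N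
length-one-to N = trans (List.length-map suc (upTo N)) (List.length-upTo N)

∈-one-to : ∀ {N j} → Letter N j → j ∈ one-to N
∈-one-to {N} {j} (1≤j , j≤N) = subst (j ∈_) (sym (one-to≡range N)) (∈-range⁺ 1 N 1≤j (s≤s j≤N))

All-one-to : ∀ N → All (Letter N) (one-to N)
All-one-to N = subst (All (Letter N)) (sym (one-to≡range N)) (All-range 1 N (λ x 1≤x x<1+N → 1≤x , ℕ.≤-pred x<1+N))

nth-one-to : ∀ N i → i < N → nth (one-to N) (suc i) ≡ suc i
nth-one-to N i i<N = trans (cong (λ z → nth z (suc i)) (one-to≡range N)) (nth-range 1 N i i<N)

Unique⇒length≤ : ∀ (xs ys : List ℕ) → Unique xs → All (_∈ ys) xs → length xs ≤ length ys
Unique⇒length≤ []       ys _               _             = z≤n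
Unique⇒length≤ (x ∷ xs) ys (x∉xs ∷ uniq) (x∈ys ∷ xs⊆ys) =
  ℕ.≤-trans (s≤s (Unique⇒length≤ xs ys∖x uniq (⊆ys∖x x∉xs xs⊆ys)))
            (List.filter-notAll ≢x? ys (Any.map (λ x≡y y≢x → y≢x (sym x≡y)) x∈ys))
  where
  ≢x? = λ y → ¬? (y ≟ x)
  ys∖x = filter ≢x? ys
  ⊆ys∖x : ∀ {zs} → All (x ≢_) zs → All (_∈ ys) zs → All (_∈ ys∖x) zs
  ⊆ys∖x []               []             = []
  ⊆ys∖x (x≢z ∷ x≢zs) (z∈ys ∷ zs⊆ys) = ∈-filter⁺ ≢x? z∈ys (x≢z ∘ sym) ∷ ⊆ys∖x x≢zs zs⊆ys

-- Pigeonhole: if j were missing, the N distinct letters of π would lie in [1..N] ∖ {j}.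
IsPerm⇒∈ : ∀ π → IsPerm π → ∀ {j} → Letter (length π) j → j ∈ π
IsPerm⇒∈ π (uniq , letters) {j} j-letter with j ∈? π
... | yes j∈π = j∈π
... | no  j∉π = ⊥-elim (ℕ.<⇒≱ fewer-letters (Unique⇒length≤ π others uniq (All.tabulate ∈others)))
  where
  N = length π
  ≢j? = λ y → ¬? (y ≟ j)
  others = filter ≢j? (one-to N)
  ∈others : ∀ {z} → z ∈ π → z ∈ others
  ∈others z∈π = ∈-filter⁺ ≢j? (∈-one-to (All.lookup letters z∈π)) (λ z≡j → j∉π (subst (_∈ π) z≡j z∈π))
  fewer-letters : length others < N
  fewer-letters = subst (length others <_) (length-one-to N)
    (List.filter-notAll ≢j? (one-to N) (Any.map (λ j≡y y≢j → y≢j (sym j≡y)) (∈-one-to j-letter)))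

-- Standardisation

countAbove countBelow : ℕ → List ℕ → ℕ
countAbove x ws = length (filterᵇ (x <ᵇ_) ws)
countBelow x ws = length (filterᵇ (_<ᵇ x) ws)

countAbove+countBelow-∷ : ∀ {x y} ws → x ≢ y →
  countAbove x (y ∷ ws) +ℕ countBelow x (y ∷ ws) ≡ suc (countAbove x ws +ℕ countBelow x ws)
countAbove+countBelow-∷ {x} {y} ws x≢y rewrite <ᵇ-flip x≢y with y <ᵇ x
... | true  = ℕ.+-suc _ _
... | false = refl

countAbove+countBelow : ∀ x ws → All (x ≢_) ws → countAbove x ws +ℕ countBelow x ws ≡ length ws
countAbove+countBelow x []       []           = refl
countAbove+countBelow x (y ∷ ws) (x≢y ∷ x≢ws) =
  trans (countAbove+countBelow-∷ ws x≢y) (cong suc (countAbove+countBelow x ws x≢ws))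

countAbove+rank : ∀ x ws → Unique ws → x ∈ ws → countAbove x ws +ℕ suc (countBelow x ws) ≡ length ws
countAbove+rank x (x ∷ ws) (x∉ws ∷ _) (here refl) rewrite <ᵇ-irrefl x =
  trans (ℕ.+-suc _ _) (cong suc (countAbove+countBelow x ws x∉ws))
countAbove+rank x (y ∷ ws) (y∉ws ∷ uniq) (there x∈ws) =
  trans (ℕ.+-suc (countAbove x (y ∷ ws)) (countBelow x (y ∷ ws)))
    (cong suc (trans (countAbove+countBelow-∷ ws x≢y)
      (trans (sym (ℕ.+-suc (countAbove x ws) (countBelow x ws))) (countAbove+rank x ws uniq x∈ws))))
  where
  x≢y : x ≢ y
  x≢y x≡y = All.lookup y∉ws x∈ws (sym x≡y)

length∸countBelow : ∀ x ws → Unique ws → x ∈ ws → length ws ∸ countBelow x ws ≡ suc (countAbove x ws)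
length∸countBelow x ws uniq x∈ws = begin
    length ws ∸ countBelow x ws
  ≡⟨ cong (_∸ countBelow x ws) (sym (countAbove+rank x ws uniq x∈ws)) ⟩
    countAbove x ws +ℕ suc (countBelow x ws) ∸ countBelow x ws
  ≡⟨ cong (_∸ countBelow x ws) (ℕ.+-suc (countAbove x ws) (countBelow x ws)) ⟩
    suc (countAbove x ws) +ℕ countBelow x ws ∸ countBelow x ws
  ≡⟨ ℕ.m+n∸n≡m (suc (countAbove x ws)) (countBelow x ws) ⟩
    suc (countAbove x ws)
  ∎
  where open ≡-Reasoning

reflect-<ᵇ : ∀ {N a b} → a ≤ N → b ≤ N → (suc N ∸ b <ᵇ suc N ∸ a) ≡ (a <ᵇ b)
reflect-<ᵇ {N} {a} {b} a≤N b≤N = ⇔→≡ {z = true} (mk⇔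
  (λ e → <⇒<ᵇ (ℕ.∸-cancelʳ-< {b} {a} {suc N} (<ᵇ⇒< e)))
  (λ e → <⇒<ᵇ (ℕ.∸-monoʳ-< (<ᵇ⇒< {a} e) (ℕ.m≤n⇒m≤1+n b≤N))))

std-reverse : ∀ w → std (reverse w) ≡ reverse (std w)
std-reverse w = trans (List.map-cong (λ x → cong suc (countBelow-reverse x)) (reverse w)) (List.reverse-map _ w)
  where
  countBelow-reverse : ∀ x → countBelow x (reverse w) ≡ countBelow x w
  countBelow-reverse x = ↭.↭-length (↭.filter-↭ (λ y → T? (y <ᵇ x)) (↭.↭-reverse w))

std-map-reflect : ∀ N w → Unique w → All (_≤ N) w → std (map (suc N ∸_) w) ≡ compl (std w)
std-map-reflect N w uniq w≤N = begin
    std (map c w)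
  ≡⟨ sym (List.map-∘ w) ⟩
    map (λ x → suc (countBelow (c x) (map c w))) w
  ≡⟨ List.map-cong-local (All.tabulate rank-reflect) ⟩
    map (λ x → suc (length (std w)) ∸ suc (countBelow x w)) w
  ≡⟨ List.map-∘ w ⟩
    compl (std w)
  ∎
  where
  open ≡-Reasoning
  c = suc N ∸_
  rank-reflect : ∀ {x} → x ∈ w → suc (countBelow (c x) (map c w)) ≡ suc (length (std w)) ∸ suc (countBelow x w)
  rank-reflect {x} x∈w = begin
      suc (length (filterᵇ (_<ᵇ c x) (map c w)))
    ≡⟨ cong (suc ∘ length) (filterᵇ-map (_<ᵇ c x) c w) ⟩
      suc (length (map c (filterᵇ (λ y → c y <ᵇ c x) w)))
    ≡⟨ cong suc (List.length-map c (filterᵇ (λ y → c y <ᵇ c x) w)) ⟩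
      suc (length (filterᵇ (λ y → c y <ᵇ c x) w))
    ≡⟨ cong (suc ∘ length) (filterᵇ-cong (All.map (reflect-<ᵇ (All.lookup w≤N x∈w)) w≤N)) ⟩
      suc (countAbove x w)
    ≡⟨ sym (length∸countBelow x w uniq x∈w) ⟩
      length w ∸ countBelow x w
    ≡⟨ cong (_∸ countBelow x w) (sym (List.length-map _ w)) ⟩
      length (std w) ∸ countBelow x w
    ∎

std-letters : ∀ w → Unique w → All (Letter (length (std w))) (std w)
std-letters w uniq = subst (λ L → All (Letter L) (std w)) (sym (List.length-map _ w))
  (All.map⁺ (All.tabulate (λ {x} x∈w → s≤s z≤n ,
     subst (suc (countBelow x w) ≤_) (countAbove+rank x w uniq x∈w) (ℕ.m≤n+m _ _))))

-- Reverse, complement and inverse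

length-compl : ∀ σ → length (compl σ) ≡ length σ
length-compl σ = List.length-map (suc (length σ) ∸_) σ

compl-involutive : ∀ σ → All (Letter (length σ)) σ → compl (compl σ) ≡ σ
compl-involutive σ letters = begin
    map (suc (length (compl σ)) ∸_) (compl σ)
  ≡⟨ cong (λ L → map (suc L ∸_) (compl σ)) (length-compl σ) ⟩
    map c (map c σ)
  ≡⟨ sym (List.map-∘ σ) ⟩
    map (c ∘ c) σ
  ≡⟨ List.map-id-local (All.map (λ (_ , x≤L) → ℕ.m∸[m∸n]≡n (ℕ.m≤n⇒m≤1+n x≤L)) letters) ⟩
    σ
  ∎
  where
  open ≡-Reasoning
  c = suc (length σ) ∸_

compl-reverse : ∀ σ → compl (reverse σ) ≡ reverse (compl σ)
compl-reverse σ = trans (cong (λ L → map (suc L ∸_) (reverse σ)) (List.length-reverse σ)) (List.reverse-map _ σ)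

IsPerm-compl : ∀ π → IsPerm π → IsPerm (compl π)
IsPerm-compl π (uniq , letters) =
  Unique-map-reflect N (All.map proj₂ letters) uniq ,
  subst (λ L → All (Letter L) (compl π)) (sym (length-compl π))
    (All.map⁺ (All.map (λ (1≤x , x≤N) → ℕ.m<n⇒0<n∸m (s≤s x≤N) , ℕ.∸-monoʳ-≤ (suc N) 1≤x) letters))
  where N = length π

length-inverse : ∀ π → length (inverse π) ≡ length π
length-inverse π = trans (List.length-map _ (one-to (length π))) (length-one-to (length π))

map-reflect-one-to : ∀ N → map (suc N ∸_) (one-to N) ≡ reverse (one-to N)
map-reflect-one-to N = subst (λ xs → map (suc N ∸_) xs ≡ reverse xs) (sym (one-to≡range N)) (map-reflect-range N 1 (suc N) refl)

reflect-≡ : ∀ {N x j} → x ≤ N → suc N ∸ x ≡ j → x ≡ suc N ∸ j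
reflect-≡ x≤N refl = sym (ℕ.m∸[m∸n]≡n (ℕ.m≤n⇒m≤1+n x≤N))

reflect-≡ᵇ : ∀ {N x j} → Letter N x → Letter N j → (suc N ∸ x ≡ᵇ j) ≡ (x ≡ᵇ suc N ∸ j)
reflect-≡ᵇ {N} {x} {j} (_ , x≤N) (_ , j≤N) = ⇔→≡ {z = true} (mk⇔
  (λ e → ≡⇒≡ᵇ (reflect-≡ x≤N (≡ᵇ⇒≡ e)))
  (λ e → ≡⇒≡ᵇ (sym (reflect-≡ j≤N (sym (≡ᵇ⇒≡ {x} e))))))

inverse-compl : ∀ π → All (Letter (length π)) π → inverse (compl π) ≡ reverse (inverse π)
inverse-compl π letters = begin
    map (λ j → suc (indexOf j (map c π))) (one-to (length (compl π)))
  ≡⟨ cong (λ L → map (λ j → suc (indexOf j (map c π))) (one-to L)) (length-compl π) ⟩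
    map (λ j → suc (indexOf j (map c π))) (one-to N)
  ≡⟨ List.map-cong-local (All.map (λ j-letter → cong suc (indexOf-map c _ _ π
                                      (All.map (λ x-letter → reflect-≡ᵇ x-letter j-letter) letters)))
                                   (All-one-to N)) ⟩
    map (position ∘ c) (one-to N)
  ≡⟨ List.map-∘ (one-to N) ⟩
    map position (map c (one-to N))
  ≡⟨ cong (map position) (map-reflect-one-to N) ⟩
    map position (reverse (one-to N))
  ≡⟨ List.reverse-map position (one-to N) ⟩
    reverse (inverse π)
  ∎
  where
  open ≡-Reasoning
  N = length π
  c = suc N ∸_
  position = λ j → suc (indexOf j π)

inverse-reverse : ∀ π → IsPerm π → inverse (reverse π) ≡ compl (inverse π)
inverse-reverse π perm@(uniq , _) = begin
    map (λ j → suc (indexOf j (reverse π))) (one-to (length (reverse π)))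
  ≡⟨ cong (λ L → map (λ j → suc (indexOf j (reverse π))) (one-to L)) (List.length-reverse π) ⟩
    map (λ j → suc (indexOf j (reverse π))) (one-to N)
  ≡⟨ List.map-cong-local (All.map position-reverse (All-one-to N)) ⟩
    map (λ j → suc N ∸ position j) (one-to N)
  ≡⟨ List.map-∘ (one-to N) ⟩
    map (suc N ∸_) (inverse π)
  ≡⟨ cong (λ L → map (suc L ∸_) (inverse π)) (sym (length-inverse π)) ⟩
    compl (inverse π)
  ∎
  where
  open ≡-Reasoning
  N = length π
  position = λ j → suc (indexOf j π)
  position-reverse : ∀ {j} → Letter N j → suc (indexOf j (reverse π)) ≡ suc N ∸ position j
  position-reverse {j} j-letter = begin
      suc (indexOf j (reverse π))
    ≡⟨ sym (ℕ.m+n∸n≡m (suc (indexOf j (reverse π))) (position j)) ⟩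
      suc (indexOf j (reverse π) +ℕ position j) ∸ position j
    ≡⟨ cong (λ L → suc L ∸ position j) (indexOf-reverse π uniq (IsPerm⇒∈ π perm j-letter)) ⟩
      suc N ∸ position j
    ∎

inverse-reverse-compl : ∀ π → IsPerm π → inverse (reverse (compl π)) ≡ reverse (compl (inverse π))
inverse-reverse-compl π perm = begin
    inverse (reverse (compl π))
  ≡⟨ inverse-reverse (compl π) (IsPerm-compl π perm) ⟩
    compl (inverse (compl π))
  ≡⟨ cong compl (inverse-compl π (proj₂ perm)) ⟩
    compl (reverse (inverse π))
  ≡⟨ compl-reverse (inverse π) ⟩
    reverse (compl (inverse π))
  ∎
  where open ≡-Reasoning

nth-inverse : ∀ π i → i < length π → nth (inverse π) (suc i) ≡ suc (indexOf (suc i) π)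
nth-inverse π i i<N =
  trans (nth-map (λ j → suc (indexOf j π)) (one-to (length π)) i (subst (i <_) (sym (length-one-to (length π))) i<N))
        (cong (λ j → suc (indexOf j π)) (nth-one-to (length π) i i<N))

inverse-letters : ∀ π → IsPerm π → All (Letter (length π)) (inverse π)
inverse-letters π perm =
  All.map⁺ (All.map (λ j-letter → s≤s z≤n , indexOf<length π (IsPerm⇒∈ π perm j-letter)) (All-one-to (length π)))

-- Descents and peaks

AdjacentDistinct : List ℕ → Set
AdjacentDistinct τ = ∀ i → suc i < length τ → nth τ (suc i) ≢ nth τ (suc (suc i))

inverse-adjacentDistinct : ∀ π → IsPerm π → AdjacentDistinct (inverse π)
inverse-adjacentDistinct π perm i 1+i<L same = ℕ.1+n≢n (sym i+1≡i+2)
  where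
  1+i<N : suc i < length π
  1+i<N = subst (suc i <_) (length-inverse π) 1+i<L
  i+1≡i+2 : suc i ≡ suc (suc i)
  i+1≡i+2 = begin
      suc i
    ≡⟨ sym (nth-indexOf π (IsPerm⇒∈ π perm (s≤s z≤n , ℕ.<⇒≤ 1+i<N))) ⟩
      nth π (suc (indexOf (suc i) π))
    ≡⟨ cong (nth π) (trans (sym (nth-inverse π i (ℕ.<-trans (ℕ.n<1+n i) 1+i<N))) (trans same (nth-inverse π (suc i) 1+i<N))) ⟩
      nth π (suc (indexOf (suc (suc i)) π))
    ≡⟨ nth-indexOf π (IsPerm⇒∈ π perm (s≤s z≤n , 1+i<N)) ⟩
      suc (suc i)
    ∎
    where open ≡-Reasoning

compl-adjacentDistinct : ∀ τ → All (_≤ length τ) τ → AdjacentDistinct τ → AdjacentDistinct (compl τ)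
compl-adjacentDistinct τ τ≤L distinct i 1+i<L same =
  distinct i 1+i<L′ (reflect-injective (All-nth τ i τ≤L i<L′) (All-nth τ (suc i) τ≤L 1+i<L′)
    (trans (sym (nth-map c τ i i<L′)) (trans same (nth-map c τ (suc i) 1+i<L′))))
  where
  c = suc (length τ) ∸_
  1+i<L′ : suc i < length τ
  1+i<L′ = subst (suc i <_) (length-compl τ) 1+i<L
  i<L′ : i < length τ
  i<L′ = ℕ.<-trans (ℕ.n<1+n i) 1+i<L′

descentAt : List ℕ → ℕ → Bool
descentAt σ i = nth σ (suc i) <ᵇ nth σ i

peakAt : List ℕ → ℕ → Bool
peakAt σ i = (nth σ i <ᵇ nth σ (suc i)) ∧ (nth σ (suc (suc i)) <ᵇ nth σ (suc i))

descentAt-compl : ∀ τ → All (_≤ length τ) τ → AdjacentDistinct τ →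
                  ∀ j → suc j < length τ → descentAt (compl τ) (suc j) ≡ not (descentAt τ (suc j))
descentAt-compl τ τ≤L distinct j 1+j<L = begin
    nth (map c τ) (suc (suc j)) <ᵇ nth (map c τ) (suc j)
  ≡⟨ cong₂ _<ᵇ_ (nth-map c τ (suc j) 1+j<L) (nth-map c τ j j<L) ⟩
    c (nth τ (suc (suc j))) <ᵇ c (nth τ (suc j))
  ≡⟨ reflect-<ᵇ (All-nth τ j τ≤L j<L) (All-nth τ (suc j) τ≤L 1+j<L) ⟩
    nth τ (suc j) <ᵇ nth τ (suc (suc j))
  ≡⟨ <ᵇ-flip (distinct j 1+j<L) ⟩
    not (descentAt τ (suc j))
  ∎
  where
  open ≡-Reasoning
  c = suc (length τ) ∸_
  j<L : j < length τ
  j<L = ℕ.<-trans (ℕ.n<1+n j) 1+j<L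

descentAt-reverse : ∀ τ → AdjacentDistinct τ →
                    ∀ j → suc j < length τ → descentAt (reverse τ) (suc j) ≡ not (descentAt τ (length τ ∸ suc j))
descentAt-reverse τ distinct j 1+j<L = begin
    nth (reverse τ) (suc (suc j)) <ᵇ nth (reverse τ) (suc j)
  ≡⟨ cong₂ _<ᵇ_ (nth-reverse τ (suc j) 1+j<L) (nth-reverse τ j j<L) ⟩
    nth τ (L ∸ suc j) <ᵇ nth τ (L ∸ j)
  ≡⟨ cong₂ (λ u v → nth τ u <ᵇ nth τ v) L∸[1+j]≡1+q L∸j≡2+q ⟩
    nth τ (suc q) <ᵇ nth τ (suc (suc q))
  ≡⟨ <ᵇ-flip (distinct q (subst (_≤ L) L∸j≡2+q (ℕ.m∸n≤m L j))) ⟩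
    not (descentAt τ (suc q))
  ≡⟨ cong (not ∘ descentAt τ) (sym L∸[1+j]≡1+q) ⟩
    not (descentAt τ (L ∸ suc j))
  ∎
  where
  open ≡-Reasoning
  L = length τ
  q = L ∸ suc (suc j)
  j<L : j < L
  j<L = ℕ.<-trans (ℕ.n<1+n j) 1+j<L
  L∸[1+j]≡1+q : L ∸ suc j ≡ suc q
  L∸[1+j]≡1+q = sym (suc[n∸suc-j] L (suc j) 1+j<L)
  L∸j≡2+q : L ∸ j ≡ suc (suc q)
  L∸j≡2+q = trans (sym (suc[n∸suc-j] L j j<L)) (cong suc L∸[1+j]≡1+q)

peakAt-reverse : ∀ τ j → suc (suc j) < length τ → peakAt (reverse τ) (suc j) ≡ peakAt τ (length τ ∸ suc (suc j))
peakAt-reverse τ j 2+j<L = begin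
    (nth τʳ (suc j) <ᵇ nth τʳ (suc (suc j))) ∧ (nth τʳ (suc (suc (suc j))) <ᵇ nth τʳ (suc (suc j)))
  ≡⟨ cong₂ (λ x z → (x <ᵇ nth τʳ (suc (suc j))) ∧ (z <ᵇ nth τʳ (suc (suc j))))
           (nth-reverse τ j j<L) (nth-reverse τ (suc (suc j)) 2+j<L) ⟩
    (nth τ (L ∸ j) <ᵇ nth τʳ (suc (suc j))) ∧ (nth τ q <ᵇ nth τʳ (suc (suc j)))
  ≡⟨ cong (λ y → (nth τ (L ∸ j) <ᵇ y) ∧ (nth τ q <ᵇ y)) (nth-reverse τ (suc j) 1+j<L) ⟩
    (nth τ (L ∸ j) <ᵇ nth τ (L ∸ suc j)) ∧ (nth τ q <ᵇ nth τ (L ∸ suc j))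
  ≡⟨ cong₂ (λ u v → (nth τ v <ᵇ nth τ u) ∧ (nth τ q <ᵇ nth τ u)) L∸[1+j]≡1+q L∸j≡2+q ⟩
    (nth τ (suc (suc q)) <ᵇ nth τ (suc q)) ∧ (nth τ q <ᵇ nth τ (suc q))
  ≡⟨ ∧-comm (nth τ (suc (suc q)) <ᵇ nth τ (suc q)) (nth τ q <ᵇ nth τ (suc q)) ⟩
    peakAt τ q
  ∎
  where
  open ≡-Reasoning
  τʳ = reverse τ
  L = length τ
  q = L ∸ suc (suc j)
  1+j<L : suc j < L
  1+j<L = ℕ.<-trans (ℕ.n<1+n (suc j)) 2+j<L
  j<L : j < L
  j<L = ℕ.<-trans (ℕ.n<1+n j) 1+j<L
  L∸[1+j]≡1+q : L ∸ suc j ≡ suc q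
  L∸[1+j]≡1+q = sym (suc[n∸suc-j] L (suc j) 1+j<L)
  L∸j≡2+q : L ∸ j ≡ suc (suc q)
  L∸j≡2+q = trans (sym (suc[n∸suc-j] L j j<L)) (cong suc L∸[1+j]≡1+q)

length-filterᵇ-partition : ∀ {A : Set} (b : A → Bool) xs → length (filterᵇ b xs) +ℕ length (filterᵇ (not ∘ b) xs) ≡ length xs
length-filterᵇ-partition b xs = trans (sym (List.length-++ (filterᵇ b xs))) (↭.↭-length (filterᵇ-partition b xs))

sum-filterᵇ-partition : ∀ (b : ℕ → Bool) xs → sum (filterᵇ b xs) +ℕ sum (filterᵇ (not ∘ b) xs) ≡ sum xs
sum-filterᵇ-partition b xs = trans (sym (sum-++ (filterᵇ b xs) _)) (sum-↭ (filterᵇ-partition b xs))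

sum-range-1 : ∀ k → sum (range 1 k) ≡ suc k C 2
sum-range-1 zero    = refl
sum-range-1 (suc k) = begin
    sum (range 1 (suc k))
  ≡⟨ cong sum (range-snoc 1 k) ⟩
    sum (range 1 k ++ [ suc k ])
  ≡⟨ sum-++ (range 1 k) [ suc k ] ⟩
    sum (range 1 k) +ℕ (suc k +ℕ 0)
  ≡⟨ cong₂ _+ℕ_ (sum-range-1 k) (ℕ.+-identityʳ (suc k)) ⟩
    suc k C 2 +ℕ suc k
  ≡⟨ ℕ.+-comm (suc k C 2) (suc k) ⟩
    suc k +ℕ suc k C 2
  ≡⟨ cong (_+ℕ suc k C 2) (sym (nC1≡n (suc k))) ⟩
    suc k C 1 +ℕ suc k C 2
  ≡⟨ nCk+nC[k+1]≡[n+1]C[k+1] (suc k) 1 ⟩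
    suc (suc k) C 2
  ∎
  where open ≡-Reasoning

All-range-1 : ∀ {p} {P : ℕ → Set p} k → (∀ j → j < k → P (suc j)) → All P (range 1 k)
All-range-1 k h = All-range 1 k (λ { (suc j) _ (s≤s j<k) → h j j<k })

descents≡filterᵇ : ∀ τ k → length τ ≡ suc k → descents τ ≡ filterᵇ (descentAt τ) (range 1 k)
descents≡filterᵇ τ k L≡1+k =
  trans (cong (λ L → filterᵇ (descentAt τ) (one-to (L ∸ 1))) L≡1+k) (cong (filterᵇ (descentAt τ)) (one-to≡range k))

module _ (τ : List ℕ) (k : ℕ) (L≡1+k : length τ ≡ suc k) (τ≤L : All (_≤ length τ) τ) (distinct : AdjacentDistinct τ) where

  private
    positions = range 1 k

    j<k⇒1+j<L : ∀ {j} → j < k → suc j < length τ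
    j<k⇒1+j<L j<k = subst (_ <_) (sym L≡1+k) (s≤s j<k)

  descents-compl : descents (compl τ) ≡ filterᵇ (not ∘ descentAt τ) positions
  descents-compl = trans (descents≡filterᵇ (compl τ) k (trans (length-compl τ) L≡1+k))
    (filterᵇ-cong (All-range-1 k (λ j j<k → descentAt-compl τ τ≤L distinct j (j<k⇒1+j<L j<k))))

  descents-reverse : descents (reverse τ) ≡ filterᵇ ((not ∘ descentAt τ) ∘ (suc k ∸_)) positions
  descents-reverse = trans (descents≡filterᵇ (reverse τ) k (trans (List.length-reverse τ) L≡1+k))
    (filterᵇ-cong (All-range-1 k (λ j j<k → trans (descentAt-reverse τ distinct j (j<k⇒1+j<L j<k))
                                                   (cong (λ L → not (descentAt τ (L ∸ suc j))) L≡1+k))))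

  descents-reverse-compl : descents (reverse (compl τ)) ≡ filterᵇ (descentAt τ ∘ (suc k ∸_)) positions
  descents-reverse-compl = trans (descents≡filterᵇ (reverse (compl τ)) k (trans (List.length-reverse (compl τ)) Lᶜ≡1+k))
    (filterᵇ-cong (All-range-1 k reflected))
    where
    Lᶜ≡1+k : length (compl τ) ≡ suc k
    Lᶜ≡1+k = trans (length-compl τ) L≡1+k
    reflected : ∀ j → j < k → descentAt (reverse (compl τ)) (suc j) ≡ descentAt τ (suc k ∸ suc j)
    reflected j j<k = begin
        descentAt (reverse (compl τ)) (suc j)
      ≡⟨ descentAt-reverse (compl τ) (compl-adjacentDistinct τ τ≤L distinct) j (subst (_ <_) (sym Lᶜ≡1+k) (s≤s j<k)) ⟩
        not (descentAt (compl τ) (length (compl τ) ∸ suc j))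
      ≡⟨ cong (λ i → not (descentAt (compl τ) i)) (trans (cong (_∸ suc j) Lᶜ≡1+k) k∸j≡1+i) ⟩
        not (descentAt (compl τ) (suc i))
      ≡⟨ cong not (descentAt-compl τ τ≤L distinct i (j<k⇒1+j<L (subst (_≤ k) k∸j≡1+i (ℕ.m∸n≤m k j)))) ⟩
        not (not (descentAt τ (suc i)))
      ≡⟨ not-involutive _ ⟩
        descentAt τ (suc i)
      ≡⟨ cong (descentAt τ) (sym k∸j≡1+i) ⟩
        descentAt τ (suc k ∸ suc j)
      ∎
      where
      open ≡-Reasoning
      i = k ∸ suc j
      k∸j≡1+i : k ∸ j ≡ suc i
      k∸j≡1+i = sym (suc[n∸suc-j] k j j<k)

  des+des-compl : des τ +ℕ des (compl τ) ≡ k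
  des+des-compl = trans (cong₂ (λ u v → length u +ℕ length v) (descents≡filterᵇ τ k L≡1+k) descents-compl)
                        (trans (length-filterᵇ-partition (descentAt τ) positions) (length-range 1 k))

  maj+maj-compl : maj τ +ℕ maj (compl τ) ≡ suc k C 2
  maj+maj-compl = trans (cong₂ (λ u v → sum u +ℕ sum v) (descents≡filterᵇ τ k L≡1+k) descents-compl)
                        (trans (sum-filterᵇ-partition (descentAt τ) positions) (sum-range-1 k))

  des+des-reverse : des τ +ℕ des (reverse τ) ≡ k
  des+des-reverse = begin
      des τ +ℕ des (reverse τ)
    ≡⟨ cong₂ (λ u v → length u +ℕ length v) (descents≡filterᵇ τ k L≡1+k) descents-reverse ⟩
      length (filterᵇ (descentAt τ) positions) +ℕ length (filterᵇ ((not ∘ descentAt τ) ∘ (suc k ∸_)) positions)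
    ≡⟨ cong (length (filterᵇ (descentAt τ) positions) +ℕ_) (length-filterᵇ-reflect-range k 1 (suc k) refl (not ∘ descentAt τ)) ⟩
      length (filterᵇ (descentAt τ) positions) +ℕ length (filterᵇ (not ∘ descentAt τ) positions)
    ≡⟨ trans (length-filterᵇ-partition (descentAt τ) positions) (length-range 1 k) ⟩
      k
    ∎
    where open ≡-Reasoning

  des-reverse-compl : des (reverse (compl τ)) ≡ des τ
  des-reverse-compl = trans (cong length descents-reverse-compl)
    (trans (length-filterᵇ-reflect-range k 1 (suc k) refl (descentAt τ)) (cong length (sym (descents≡filterᵇ τ k L≡1+k))))

  maj-reverse-compl : maj (reverse (compl τ)) ≡ comaj τ
  maj-reverse-compl = begin
      sum (descents (reverse (compl τ)))
    ≡⟨ cong sum descents-reverse-compl ⟩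
      sum (filterᵇ (descentAt τ ∘ (suc k ∸_)) positions)
    ≡⟨ sum-↭ (filterᵇ-reflect-range k 1 (suc k) refl (descentAt τ)) ⟩
      sum (map (suc k ∸_) (filterᵇ (descentAt τ) positions))
    ≡⟨ sym (cong₂ (λ L ds → sum (map (L ∸_) ds)) L≡1+k (descents≡filterᵇ τ k L≡1+k)) ⟩
      comaj τ
    ∎
    where open ≡-Reasoning

pk-reverse : ∀ τ → pk (reverse τ) ≡ pk τ
pk-reverse τ = begin
    length (filterᵇ (peakAt (reverse τ)) (one-to (length (reverse τ) ∸ 2)))
  ≡⟨ cong (λ L → length (filterᵇ (peakAt (reverse τ)) (one-to (L ∸ 2)))) (List.length-reverse τ) ⟩
    length (filterᵇ (peakAt (reverse τ)) (one-to k))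
  ≡⟨ cong (length ∘ filterᵇ (peakAt (reverse τ))) (one-to≡range k) ⟩
    length (filterᵇ (peakAt (reverse τ)) (range 1 k))
  ≡⟨ cong length (filterᵇ-cong (All-range-1 k reflected)) ⟩
    length (filterᵇ (peakAt τ ∘ (suc k ∸_)) (range 1 k))
  ≡⟨ length-filterᵇ-reflect-range k 1 (suc k) refl (peakAt τ) ⟩
    length (filterᵇ (peakAt τ) (range 1 k))
  ≡⟨ cong (length ∘ filterᵇ (peakAt τ)) (sym (one-to≡range k)) ⟩
    pk τ
  ∎
  where
  open ≡-Reasoning
  L = length τ
  k = L ∸ 2
  reflected : ∀ j → j < k → peakAt (reverse τ) (suc j) ≡ peakAt τ (suc k ∸ suc j)
  reflected j j<k = trans (peakAt-reverse τ j (2+j<L L j<k)) (cong (peakAt τ) (sym (ℕ.∸-+-assoc L 2 j)))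
    where
    2+j<L : ∀ L → j < L ∸ 2 → suc (suc j) < L
    2+j<L (suc (suc L)) j<L = s≤s (s≤s j<L)


module _ (π : List ℕ) (k : ℕ) (L≡1+k : length π ≡ suc k) (perm : IsPerm π) where

  private
    τ = inverse π
    Lτ≡1+k : length τ ≡ suc k
    Lτ≡1+k = trans (length-inverse π) L≡1+k
    τ≤L : All (_≤ length τ) τ
    τ≤L = subst (λ L → All (_≤ L) τ) (sym (length-inverse π)) (All.map proj₂ (inverse-letters π perm))
    distinct : AdjacentDistinct τ
    distinct = inverse-adjacentDistinct π perm

  ides+ides-reverse : ides π +ℕ ides (reverse π) ≡ k
  ides+ides-reverse = trans (cong (λ σ → ides π +ℕ des σ) (inverse-reverse π perm)) (des+des-compl τ k Lτ≡1+k τ≤L distinct)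

  imaj+imaj-reverse : imaj π +ℕ imaj (reverse π) ≡ suc k C 2
  imaj+imaj-reverse = trans (cong (λ σ → imaj π +ℕ maj σ) (inverse-reverse π perm)) (maj+maj-compl τ k Lτ≡1+k τ≤L distinct)

  ides+ides-compl : ides π +ℕ ides (compl π) ≡ k
  ides+ides-compl =
    trans (cong (λ σ → ides π +ℕ des σ) (inverse-compl π (proj₂ perm))) (des+des-reverse τ k Lτ≡1+k τ≤L distinct)

  ides-reverse-compl : ides (reverse (compl π)) ≡ ides π
  ides-reverse-compl = trans (cong des (inverse-reverse-compl π perm)) (des-reverse-compl τ k Lτ≡1+k τ≤L distinct)

  imaj-reverse-compl : imaj (reverse (compl π)) ≡ icomaj π
  imaj-reverse-compl = trans (cong maj (inverse-reverse-compl π perm)) (maj-reverse-compl τ k Lτ≡1+k τ≤L distinct)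

ipk-compl : ∀ π → IsPerm π → ipk (compl π) ≡ ipk π
ipk-compl π (_ , letters) = trans (cong pk (inverse-compl π letters)) (pk-reverse (inverse π))

-- Consecutive pattern occurrences

drop-length-++ : ∀ (xs ys : List ℕ) → drop (length xs) (xs ++ ys) ≡ ys
drop-length-++ []       ys = refl
drop-length-++ (x ∷ xs) ys = drop-length-++ xs ys

take-length-++ : ∀ (xs ys : List ℕ) → take (length xs) (xs ++ ys) ≡ xs
take-length-++ []       ys = refl
take-length-++ (x ∷ xs) ys = cong (x ∷_) (take-length-++ xs ys)

window-reverse : ∀ π j m i → length π ≡ j +ℕ (m +ℕ i) → take m (drop i (reverse π)) ≡ reverse (take m (drop j π))
window-reverse π j m i L≡j+m+i = begin
    take m (drop i (reverse π))
  ≡⟨ cong (λ z → take m (drop i (reverse z))) (sym π≡A++B++C) ⟩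
    take m (drop i (reverse (A ++ (B ++ C))))
  ≡⟨ cong (λ z → take m (drop i z)) (trans (List.reverse-++ A (B ++ C))
       (trans (cong (_++ reverse A) (List.reverse-++ B C)) (List.++-assoc (reverse C) (reverse B) (reverse A)))) ⟩
    take m (drop i (reverse C ++ (reverse B ++ reverse A)))
  ≡⟨ cong (λ n → take m (drop n (reverse C ++ (reverse B ++ reverse A)))) (sym (trans (List.length-reverse C) |C|≡i)) ⟩
    take m (drop (length (reverse C)) (reverse C ++ (reverse B ++ reverse A)))
  ≡⟨ cong (take m) (drop-length-++ (reverse C) _) ⟩
    take m (reverse B ++ reverse A)
  ≡⟨ cong (λ n → take n (reverse B ++ reverse A)) (sym (trans (List.length-reverse B) |B|≡m)) ⟩
    take (length (reverse B)) (reverse B ++ reverse A)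
  ≡⟨ take-length-++ (reverse B) _ ⟩
    reverse B
  ∎
  where
  open ≡-Reasoning
  A = take j π
  R = drop j π
  B = take m R
  C = drop m R
  π≡A++B++C : A ++ (B ++ C) ≡ π
  π≡A++B++C = trans (cong (A ++_) (List.take++drop≡id m R)) (List.take++drop≡id j π)
  |R|≡m+i : length R ≡ m +ℕ i
  |R|≡m+i = trans (List.length-drop j π) (trans (cong (_∸ j) L≡j+m+i) (ℕ.m+n∸m≡n j (m +ℕ i)))
  |B|≡m : length B ≡ m
  |B|≡m = trans (List.length-take m R) (trans (cong (m Data.Nat.⊓_) |R|≡m+i) (ℕ.m≤n⇒m⊓n≡m (ℕ.m≤m+n m i)))
  |C|≡i : length C ≡ i
  |C|≡i = trans (List.length-drop m R) (trans (cong (_∸ m) |R|≡m+i) (ℕ.m+n∸m≡n m i))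

-- occ Δ π unfolds to occWithin Δ π (length π); abstracting the length lets it be rewritten along
-- length-reverse and length-compl.
windowCount : PermSet → List ℕ → ℕ → ℕ → ℕ
windowCount Δ π N m = length (filterᵇ (λ i → Δ (std (take m (drop i π)))) (upTo (suc (N ∸ m))))

occWithin : PermSet → List ℕ → ℕ → ℕ
occWithin Δ π N = sum (map (windowCount Δ π N) (upTo (suc N)))

All-upTo-suc : ∀ {p} {P : ℕ → Set p} K → (∀ x → x ≤ K → P x) → All P (upTo (suc K))
All-upTo-suc {P = P} K h = subst (All P) (sym (upTo≡range (suc K))) (All-range 0 (suc K) (λ x _ x<1+K → h x (ℕ.≤-pred x<1+K)))

length≡start+window+rest : ∀ {N m i} → m ≤ N → i ≤ N ∸ m → N ≡ (N ∸ m ∸ i) +ℕ (m +ℕ i)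
length≡start+window+rest {N} {m} {i} m≤N i≤K = sym (begin
    (N ∸ m ∸ i) +ℕ (m +ℕ i)
  ≡⟨ cong ((N ∸ m ∸ i) +ℕ_) (ℕ.+-comm m i) ⟩
    (N ∸ m ∸ i) +ℕ (i +ℕ m)
  ≡⟨ sym (ℕ.+-assoc (N ∸ m ∸ i) i m) ⟩
    (N ∸ m ∸ i) +ℕ i +ℕ m
  ≡⟨ cong (_+ℕ m) (ℕ.m∸n+n≡m i≤K) ⟩
    (N ∸ m) +ℕ m
  ≡⟨ ℕ.m∸n+n≡m m≤N ⟩
    N
  ∎)
  where open ≡-Reasoning

-- The window starting at i in π^r is the reverse of the window starting at N - m - i in π.
windowCount-reverse : ∀ (Δ Δ′ : PermSet) → (∀ w → Δ (reverse w) ≡ Δ′ w) → ∀ π m → m ≤ length π →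
                      windowCount Δ (reverse π) (length π) m ≡ windowCount Δ′ π (length π) m
windowCount-reverse Δ Δ′ Δ∘reverse≗Δ′ π m m≤N = begin
    length (filterᵇ inReverse (upTo (suc K)))
  ≡⟨ cong (length ∘ filterᵇ inReverse) (upTo≡range (suc K)) ⟩
    length (filterᵇ inReverse starts)
  ≡⟨ cong length (filterᵇ-cong (All-range 0 (suc K) reflected-start)) ⟩
    length (filterᵇ (inπ ∘ (K ∸_)) starts)
  ≡⟨ length-filterᵇ-reflect-range (suc K) 0 K refl inπ ⟩
    length (filterᵇ inπ starts)
  ≡⟨ cong (length ∘ filterᵇ inπ) (sym (upTo≡range (suc K))) ⟩
    length (filterᵇ inπ (upTo (suc K)))
  ∎
  where
  open ≡-Reasoning
  K = length π ∸ m
  starts = range 0 (suc K)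
  inReverse inπ : ℕ → Bool
  inReverse i = Δ (std (take m (drop i (reverse π))))
  inπ i = Δ′ (std (take m (drop i π)))
  reflected-start : ∀ i → 0 ≤ i → i < suc K → inReverse i ≡ inπ (K ∸ i)
  reflected-start i _ i<1+K = begin
      Δ (std (take m (drop i (reverse π))))
    ≡⟨ cong (Δ ∘ std) (window-reverse π (K ∸ i) m i (length≡start+window+rest m≤N (ℕ.≤-pred i<1+K))) ⟩
      Δ (std (reverse (take m (drop (K ∸ i) π))))
    ≡⟨ cong Δ (std-reverse (take m (drop (K ∸ i) π))) ⟩
      Δ (reverse (std (take m (drop (K ∸ i) π))))
    ≡⟨ Δ∘reverse≗Δ′ _ ⟩
      inπ (K ∸ i)
    ∎

occ-reverse : ∀ (Δ Δ′ : PermSet) → (∀ w → Δ (reverse w) ≡ Δ′ w) → ∀ π → occ Δ (reverse π) ≡ occ Δ′ π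
occ-reverse Δ Δ′ Δ∘reverse≗Δ′ π =
  trans (cong (occWithin Δ (reverse π)) (List.length-reverse π))
        (cong sum (List.map-cong-local (All-upTo-suc (length π) (windowCount-reverse Δ Δ′ Δ∘reverse≗Δ′ π))))

occ-compl : ∀ (Δ Δ′ : PermSet) → (∀ σ → All (Letter (length σ)) σ → Δ (compl σ) ≡ Δ′ σ) →
            ∀ π → Unique π → All (_≤ length π) π → occ Δ (compl π) ≡ occ Δ′ π
occ-compl Δ Δ′ Δ∘compl≗Δ′ π uniq π≤N = trans (cong (occWithin Δ (compl π)) (length-compl π))
  (cong sum (List.map-cong (λ m → cong length (filterᵇ-cong {xs = upTo (suc (N ∸ m))} (All.tabulate (λ {i} _ → same-window m i))))
                           (upTo (suc N))))
  where
  N = length π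
  same-window : ∀ m i → Δ (std (take m (drop i (compl π)))) ≡ Δ′ (std (take m (drop i π)))
  same-window m i = begin
      Δ (std (take m (drop i (map (suc N ∸_) π))))
    ≡⟨ cong (Δ ∘ std) (trans (cong (take m) (List.drop-map i π)) (List.take-map m (drop i π))) ⟩
      Δ (std (map (suc N ∸_) w))
    ≡⟨ cong Δ (std-map-reflect N w uniq-w (All.take⁺ m (All.drop⁺ i π≤N))) ⟩
      Δ (compl (std w))
    ≡⟨ Δ∘compl≗Δ′ (std w) (std-letters w uniq-w) ⟩
      Δ′ (std w)
    ∎
    where
    open ≡-Reasoning
    w = take m (drop i π)
    uniq-w : Unique w
    uniq-w = Unique.take⁺ m (Unique.drop⁺ i uniq)

occ-ʳ-reverse : ∀ Γ π → occ (Γ ʳ) (reverse π) ≡ occ Γ π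
occ-ʳ-reverse Γ = occ-reverse (Γ ʳ) Γ (cong Γ ∘ List.reverse-involutive)

occ-ᶜ-compl : ∀ Γ π → IsPerm π → occ (Γ ᶜ) (compl π) ≡ occ Γ π
occ-ᶜ-compl Γ π (uniq , letters) =
  occ-compl (Γ ᶜ) Γ (λ σ σ-letters → cong Γ (compl-involutive σ σ-letters)) π uniq (All.map proj₂ letters)

occ-ʳᶜ-reverse-compl : ∀ Γ π → IsPerm π → occ (Γ ʳᶜ) (reverse (compl π)) ≡ occ Γ π
occ-ʳᶜ-reverse-compl Γ π (uniq , letters) =
  trans (occ-reverse (Γ ʳᶜ) (Γ ʳᶜ ∘ reverse) (λ _ → refl) (compl π))
        (occ-compl (Γ ʳᶜ ∘ reverse) Γ rc∘r∘c≗id π uniq (All.map proj₂ letters))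
  where
  rc∘r∘c≗id : ∀ σ → All (Letter (length σ)) σ → Γ (reverse (compl (reverse (compl σ)))) ≡ Γ σ
  rc∘r∘c≗id σ σ-letters = cong Γ (trans (cong reverse (compl-reverse (compl σ)))
                                  (trans (List.reverse-involutive (compl (compl σ))) (compl-involutive σ σ-letters)))

-- Generating functions

module _ {c ℓ} (R : CommutativeRing c ℓ) where
  open CommutativeRing R
    using (Carrier; _≈_; _+_; _*_; 0#; 1#; +-cong; +-congˡ; *-cong; *-congˡ; +-identityˡ; +-identityʳ; +-assoc; +-comm; *-comm;
           *-identityˡ; *-identityʳ; *-assoc; zeroʳ; distribˡ; +-commutativeSemigroup; *-commutativeSemigroup)
    renaming (refl to ≈-refl; reflexive to ≈-reflexive; sym to ≈-sym; trans to ≈-trans; setoid to ≈-setoid)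
  open GF R
  open SetoidReasoning ≈-setoid
  module *-CS = CommSemigroup *-commutativeSemigroup
  module +-CS = CommSemigroup +-commutativeSemigroup

  sumOver : {A : Set} → List A → (A → Carrier) → Carrier
  sumOver xs f = foldr (λ x acc → f x + acc) 0# xs

  sumOver-cong : ∀ {A : Set} (xs : List A) {f g : A → Carrier} → (∀ x → f x ≈ g x) → sumOver xs f ≈ sumOver xs g
  sumOver-cong []       f≈g = ≈-refl
  sumOver-cong (x ∷ xs) f≈g = +-cong (f≈g x) (sumOver-cong xs f≈g)

  sumOver-cong-local : ∀ {A : Set} {xs : List A} {f g : A → Carrier} → All (λ x → f x ≈ g x) xs → sumOver xs f ≈ sumOver xs g
  sumOver-cong-local []         = ≈-refl
  sumOver-cong-local (e ∷ es) = +-cong e (sumOver-cong-local es)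

  sumOver-++ : ∀ {A : Set} (xs ys : List A) (f : A → Carrier) → sumOver (xs ++ ys) f ≈ sumOver xs f + sumOver ys f
  sumOver-++ []       ys f = ≈-sym (+-identityˡ _)
  sumOver-++ (x ∷ xs) ys f = ≈-trans (+-congˡ (sumOver-++ xs ys f)) (≈-sym (+-assoc _ _ _))

  sumOver-map : ∀ {A B : Set} (h : A → B) xs (f : B → Carrier) → sumOver (map h xs) f ≡ sumOver xs (f ∘ h)
  sumOver-map h []       f = refl
  sumOver-map h (x ∷ xs) f = cong (f (h x) +_) (sumOver-map h xs f)

  sumOver-concatMap : ∀ {A B : Set} (h : A → List B) xs (f : B → Carrier) →
                      sumOver (concatMap h xs) f ≈ sumOver xs (λ x → sumOver (h x) f)
  sumOver-concatMap h []       f = ≈-refl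
  sumOver-concatMap h (x ∷ xs) f = ≈-trans (sumOver-++ (h x) (concatMap h xs) f) (+-congˡ (sumOver-concatMap h xs f))

  sumOver-+ : ∀ {A : Set} (xs : List A) (f g : A → Carrier) → sumOver xs (λ x → f x + g x) ≈ sumOver xs f + sumOver xs g
  sumOver-+ []       f g = ≈-sym (+-identityˡ _)
  sumOver-+ (x ∷ xs) f g = ≈-trans (+-congˡ (sumOver-+ xs f g)) (+-CS.interchange _ _ _ _)

  sumOver-0 : ∀ {A : Set} (xs : List A) → sumOver xs (λ _ → 0#) ≈ 0#
  sumOver-0 []       = ≈-refl
  sumOver-0 (x ∷ xs) = ≈-trans (+-identityˡ _) (sumOver-0 xs)

  sumOver-swap : ∀ {A B : Set} (xs : List A) (ys : List B) (H : A → B → Carrier) →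
                 sumOver xs (λ x → sumOver ys (H x)) ≈ sumOver ys (λ y → sumOver xs (λ x → H x y))
  sumOver-swap []       ys H = ≈-sym (sumOver-0 ys)
  sumOver-swap (x ∷ xs) ys H = ≈-trans (+-congˡ (sumOver-swap xs ys H)) (≈-sym (sumOver-+ ys (H x) _))

  sumOver-reverse : ∀ {A : Set} (xs : List A) (f : A → Carrier) → sumOver (reverse xs) f ≈ sumOver xs f
  sumOver-reverse []       f = ≈-refl
  sumOver-reverse (x ∷ xs) f = begin
      sumOver (reverse (x ∷ xs)) f
    ≡⟨ cong (λ z → sumOver z f) (List.unfold-reverse x xs) ⟩
      sumOver (reverse xs ++ [ x ]) f
    ≈⟨ sumOver-++ (reverse xs) [ x ] f ⟩
      sumOver (reverse xs) f + (f x + 0#)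
    ≈⟨ +-cong (sumOver-reverse xs f) (+-identityʳ _) ⟩
      sumOver xs f + f x
    ≈⟨ +-comm _ _ ⟩
      f x + sumOver xs f
    ∎

  sumOver-scale : ∀ {A : Set} (xs : List A) a (f : A → Carrier) → sumOver xs (λ x → a * f x) ≈ a * sumOver xs f
  sumOver-scale []       a f = ≈-sym (zeroʳ a)
  sumOver-scale (x ∷ xs) a f = ≈-trans (+-congˡ (sumOver-scale xs a f)) (≈-sym (distribˡ a _ _))

  sumOver-filterᵇ : ∀ {A : Set} (b : A → Bool) xs (f : A → Carrier) →
                    sumOver (filterᵇ b xs) f ≈ sumOver xs (λ x → if b x then f x else 0#)
  sumOver-filterᵇ b []       f = ≈-refl
  sumOver-filterᵇ b (x ∷ xs) f with b x
  ... | true  = +-congˡ (sumOver-filterᵇ b xs f)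
  ... | false = ≈-trans (sumOver-filterᵇ b xs f) (≈-sym (+-identityˡ _))

  module _ (n : ℕ) where
    private
      letters = one-to n
      W = λ k → words k n

    sumOver-words-suc : ∀ k (F : List ℕ → Carrier) →
                        sumOver (W (suc k)) F ≈ sumOver letters (λ x → sumOver (W k) (λ w → F (x ∷ w)))
    sumOver-words-suc k F = ≈-trans (sumOver-concatMap (λ x → map (x ∷_) (W k)) letters F)
                                    (sumOver-cong letters (λ x → ≈-reflexive (sumOver-map (x ∷_) (W k) F)))

    sumOver-words-snoc : ∀ k (F : List ℕ → Carrier) →
                         sumOver letters (λ x → sumOver (W k) (λ w → F (w ++ [ x ]))) ≈ sumOver (W (suc k)) F
    sumOver-words-snoc zero    F = ≈-sym (sumOver-words-suc zero F)
    sumOver-words-snoc (suc k) F = begin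
        sumOver letters (λ x → sumOver (W (suc k)) (λ w → F (w ++ [ x ])))
      ≈⟨ sumOver-cong letters (λ x → sumOver-words-suc k (λ w → F (w ++ [ x ]))) ⟩
        sumOver letters (λ x → sumOver letters (λ y → sumOver (W k) (λ w → F (y ∷ (w ++ [ x ])))))
      ≈⟨ sumOver-swap letters letters (λ x y → sumOver (W k) (λ w → F (y ∷ (w ++ [ x ])))) ⟩
        sumOver letters (λ y → sumOver letters (λ x → sumOver (W k) (λ w → F (y ∷ (w ++ [ x ])))))
      ≈⟨ sumOver-cong letters (λ y → sumOver-words-snoc k (λ w → F (y ∷ w))) ⟩
        sumOver letters (λ y → sumOver (W (suc k)) (λ w → F (y ∷ w)))
      ≈⟨ sumOver-words-suc (suc k) F ⟨
        sumOver (W (suc (suc k))) F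
      ∎

    sumOver-words-reverse : ∀ k (F : List ℕ → Carrier) → sumOver (W k) (F ∘ reverse) ≈ sumOver (W k) F
    sumOver-words-reverse zero    F = ≈-refl
    sumOver-words-reverse (suc k) F = begin
        sumOver (W (suc k)) (F ∘ reverse)
      ≈⟨ sumOver-words-suc k (F ∘ reverse) ⟩
        sumOver letters (λ x → sumOver (W k) (λ w → F (reverse (x ∷ w))))
      ≈⟨ sumOver-cong letters (λ x → sumOver-cong (W k) (λ w → ≈-reflexive (cong F (List.unfold-reverse x w)))) ⟩
        sumOver letters (λ x → sumOver (W k) (λ w → F (reverse w ++ [ x ])))
      ≈⟨ sumOver-cong letters (λ x → sumOver-words-reverse k (λ w → F (w ++ [ x ]))) ⟩
        sumOver letters (λ x → sumOver (W k) (λ w → F (w ++ [ x ])))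
      ≈⟨ sumOver-words-snoc k F ⟩
        sumOver (W (suc k)) F
      ∎

    sumOver-words-reflect : ∀ k (F : List ℕ → Carrier) → sumOver (W k) (F ∘ map (suc n ∸_)) ≈ sumOver (W k) F
    sumOver-words-reflect zero    F = ≈-refl
    sumOver-words-reflect (suc k) F = begin
        sumOver (W (suc k)) (F ∘ map reflect)
      ≈⟨ sumOver-words-suc k (F ∘ map reflect) ⟩
        sumOver letters (λ x → sumOver (W k) (λ w → F (reflect x ∷ map reflect w)))
      ≈⟨ sumOver-cong letters (λ x → sumOver-words-reflect k (λ w → F (reflect x ∷ w))) ⟩
        sumOver letters (G ∘ reflect)
      ≡⟨ sumOver-map reflect letters G ⟨
        sumOver (map reflect letters) G
      ≡⟨ cong (λ xs → sumOver xs G) (map-reflect-one-to n) ⟩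
        sumOver (reverse letters) G
      ≈⟨ sumOver-reverse letters G ⟩
        sumOver letters G
      ≈⟨ sumOver-words-suc k F ⟨
        sumOver (W (suc k)) F
      ∎
      where
      reflect = suc n ∸_
      G = λ y → sumOver (W k) (λ w → F (y ∷ w))

  words-letters : ∀ k n → All (λ w → length w ≡ k × All (Letter n) w) (words k n)
  words-letters zero    n = (refl , []) ∷ []
  words-letters (suc k) n = All.concat⁺ (All.map⁺ (All.map (λ x-letter →
    All.map⁺ (All.map (λ (|w|≡k , w-letters) → cong suc |w|≡k , x-letter ∷ w-letters) (words-letters k n))) (All-one-to n)))

  perms-IsPerm : ∀ n → All (λ π → length π ≡ n × IsPerm π) (perms n)
  perms-IsPerm n = All.map (λ { {π} ((|π|≡n , π-letters) , distinct) →
      |π|≡n , distinctᵇ⇒Unique π (T⇒≡true distinct) , subst (λ L → All (Letter L) π) (sym |π|≡n) π-letters })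
    (All.zip (All.filter⁺ distinct? (words-letters n n) , All.all-filter distinct? (words n n)))
    where distinct? = λ w → T? (distinctᵇ w)

  Σ-perms-cong : ∀ n {f g : List ℕ → Carrier} → (∀ π → length π ≡ n → IsPerm π → f π ≈ g π) →
                 Σ (perms n) f ≈ Σ (perms n) g
  Σ-perms-cong n f≈g = sumOver-cong-local (All.map (λ { {π} (|π|≡n , perm) → f≈g π |π|≡n perm }) (perms-IsPerm n))

  Σ-perms-reverse : ∀ n (f : List ℕ → Carrier) → Σ (perms n) (f ∘ reverse) ≈ Σ (perms n) f
  Σ-perms-reverse n f = begin
      Σ (perms n) (f ∘ reverse)
    ≈⟨ sumOver-filterᵇ distinctᵇ (words n n) (f ∘ reverse) ⟩
      sumOver (words n n) (λ w → if distinctᵇ w then f (reverse w) else 0#)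
    ≈⟨ sumOver-cong (words n n) (λ w → ≈-reflexive (cong (λ d → if d then f (reverse w) else 0#) (sym (distinctᵇ-reverse w)))) ⟩
      sumOver (words n n) (F ∘ reverse)
    ≈⟨ sumOver-words-reverse n n F ⟩
      sumOver (words n n) F
    ≈⟨ sumOver-filterᵇ distinctᵇ (words n n) f ⟨
      Σ (perms n) f
    ∎
    where F = λ w → if distinctᵇ w then f w else 0#

  Σ-perms-compl : ∀ n (f : List ℕ → Carrier) → Σ (perms n) (f ∘ compl) ≈ Σ (perms n) f
  Σ-perms-compl n f = begin
      Σ (perms n) (f ∘ compl)
    ≈⟨ sumOver-filterᵇ distinctᵇ (words n n) (f ∘ compl) ⟩
      sumOver (words n n) (λ w → if distinctᵇ w then f (compl w) else 0#)
    ≈⟨ sumOver-cong-local (All.map (λ (|w|≡n , w-letters) → ≈-reflexive (reflected _ |w|≡n w-letters)) (words-letters n n)) ⟩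
      sumOver (words n n) (F ∘ map (suc n ∸_))
    ≈⟨ sumOver-words-reflect n n F ⟩
      sumOver (words n n) F
    ≈⟨ sumOver-filterᵇ distinctᵇ (words n n) f ⟨
      Σ (perms n) f
    ∎
    where
    F = λ w → if distinctᵇ w then f w else 0#
    reflected : ∀ w → length w ≡ n → All (Letter n) w → (if distinctᵇ w then f (compl w) else 0#) ≡ F (map (suc n ∸_) w)
    reflected w |w|≡n w-letters =
      trans (cong (λ L → if distinctᵇ w then f (map (suc L ∸_) w) else 0#) |w|≡n)
            (cong (λ d → if d then f (map (suc n ∸_) w) else 0#) (sym (distinctᵇ-map-reflect n w (All.map proj₂ w-letters))))

  Σ-perms-reverse-compl : ∀ n (f : List ℕ → Carrier) → Σ (perms n) (f ∘ reverse ∘ compl) ≈ Σ (perms n) f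
  Σ-perms-reverse-compl n f = ≈-trans (Σ-perms-compl n (f ∘ reverse)) (Σ-perms-reverse n f)

  pow-+ : ∀ x a b → pow x (a +ℕ b) ≈ pow x a * pow x b
  pow-+ x zero    b = ≈-sym (*-identityˡ _)
  pow-+ x (suc a) b = ≈-trans (*-congˡ (pow-+ x a b)) (≈-sym (*-assoc _ _ _))

  pow-inverse : ∀ {t t⁻¹} → t * t⁻¹ ≈ 1# → ∀ b → pow t b * pow t⁻¹ b ≈ 1#
  pow-inverse tt⁻¹≈1 zero    = *-identityʳ 1#
  pow-inverse tt⁻¹≈1 (suc b) = ≈-trans (*-CS.interchange _ _ _ _)
    (≈-trans (*-cong tt⁻¹≈1 (pow-inverse tt⁻¹≈1 b)) (*-identityʳ 1#))

  pow-shift : ∀ {t t⁻¹} → t * t⁻¹ ≈ 1# → ∀ a b {M} → b +ℕ a ≡ M → pow t a ≈ pow t M * pow t⁻¹ b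
  pow-shift {t} {t⁻¹} tt⁻¹≈1 a b refl = ≈-sym (begin
      pow t (b +ℕ a) * pow t⁻¹ b
    ≈⟨ *-cong (≈-trans (pow-+ t b a) (*-comm _ _)) ≈-refl ⟩
      pow t a * pow t b * pow t⁻¹ b
    ≈⟨ *-assoc _ _ _ ⟩
      pow t a * (pow t b * pow t⁻¹ b)
    ≈⟨ *-congˡ (pow-inverse tt⁻¹≈1 b) ⟩
      pow t a * 1#
    ≈⟨ *-identityʳ _ ⟩
      pow t a
    ∎)

  module _ (Γ : PermSet) (k : ℕ) (s : Carrier) where
    private
      n = suc k

      pow-complementary : ∀ {t t⁻¹} → t * t⁻¹ ≈ 1# → ∀ x y → x +ℕ y ≡ k →
                          pow t (y +ℕ 1) ≈ pow t (n +ℕ 1) * pow t⁻¹ (x +ℕ 1)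
      pow-complementary tt⁻¹≈1 x y x+y≡k =
        pow-shift tt⁻¹≈1 (y +ℕ 1) (x +ℕ 1) (trans (+1+1 x y) (cong (λ m → suc m +ℕ 1) x+y≡k))
        where
        +1+1 : ∀ x y → (x +ℕ 1) +ℕ (y +ℕ 1) ≡ suc (x +ℕ y) +ℕ 1
        +1+1 = solve-∀

    A-ides-imaj-reverse : ∀ t t⁻¹ q q⁻¹ → t * t⁻¹ ≈ 1# → q * q⁻¹ ≈ 1# →
      A-ides-imaj (Γ ʳ) n s t q ≈ pow t (n +ℕ 1) * pow q (n C 2) * A-ides-imaj Γ n s t⁻¹ q⁻¹
    A-ides-imaj-reverse t t⁻¹ q q⁻¹ tt⁻¹≈1 qq⁻¹≈1 = begin
        A-ides-imaj (Γ ʳ) n s t q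
      ≈⟨ Σ-perms-reverse n summand ⟨
        Σ (perms n) (summand ∘ reverse)
      ≈⟨ Σ-perms-cong n reindexed ⟩
        Σ (perms n) (λ π → factor * summand⁻¹ π)
      ≈⟨ sumOver-scale (perms n) factor summand⁻¹ ⟩
        factor * A-ides-imaj Γ n s t⁻¹ q⁻¹
      ∎
      where
      summand summand⁻¹ : List ℕ → Carrier
      summand π = pow s (occ (Γ ʳ) π) * pow t (ides π +ℕ 1) * pow q (imaj π)
      summand⁻¹ π = pow s (occ Γ π) * pow t⁻¹ (ides π +ℕ 1) * pow q⁻¹ (imaj π)
      factor : Carrier
      factor = pow t (n +ℕ 1) * pow q (n C 2)
      reindexed : ∀ π → length π ≡ n → IsPerm π → summand (reverse π) ≈ factor * summand⁻¹ π
      reindexed π |π|≡n perm = begin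
          summand (reverse π)
        ≈⟨ *-cong (*-cong (≈-reflexive (cong (pow s) (occ-ʳ-reverse Γ π)))
                          (pow-complementary tt⁻¹≈1 (ides π) (ides (reverse π)) (ides+ides-reverse π k |π|≡n perm)))
                  (pow-shift qq⁻¹≈1 (imaj (reverse π)) (imaj π) (imaj+imaj-reverse π k |π|≡n perm)) ⟩
          pow s (occ Γ π) * (pow t (n +ℕ 1) * pow t⁻¹ (ides π +ℕ 1)) * (pow q (n C 2) * pow q⁻¹ (imaj π))
        ≈⟨ *-cong (*-CS.x∙yz≈y∙xz _ _ _) ≈-refl ⟩
          pow t (n +ℕ 1) * (pow s (occ Γ π) * pow t⁻¹ (ides π +ℕ 1)) * (pow q (n C 2) * pow q⁻¹ (imaj π))
        ≈⟨ *-CS.interchange _ _ _ _ ⟩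
          factor * summand⁻¹ π
        ∎

    A-ides-imaj-reverse-compl : ∀ t q → A-ides-imaj (Γ ʳᶜ) n s t q ≈ A-ides-icomaj Γ n s t q
    A-ides-imaj-reverse-compl t q = ≈-trans (≈-sym (Σ-perms-reverse-compl n summand)) (Σ-perms-cong n reindexed)
      where
      summand : List ℕ → Carrier
      summand π = pow s (occ (Γ ʳᶜ) π) * pow t (ides π +ℕ 1) * pow q (imaj π)
      reindexed : ∀ π → length π ≡ n → IsPerm π →
                  summand (reverse (compl π)) ≈ pow s (occ Γ π) * pow t (ides π +ℕ 1) * pow q (icomaj π)
      reindexed π |π|≡n perm = ≈-reflexive (cong₂ _*_
        (cong₂ _*_ (cong (pow s) (occ-ʳᶜ-reverse-compl Γ π perm))
                   (cong (λ d → pow t (d +ℕ 1)) (ides-reverse-compl π k |π|≡n perm)))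
        (cong (pow q) (imaj-reverse-compl π k |π|≡n perm)))

    A-ides-reverse-compl : ∀ t → A-ides (Γ ʳᶜ) n s t ≈ A-ides Γ n s t
    A-ides-reverse-compl t = ≈-trans (≈-sym (Σ-perms-reverse-compl n summand)) (Σ-perms-cong n reindexed)
      where
      summand : List ℕ → Carrier
      summand π = pow s (occ (Γ ʳᶜ) π) * pow t (ides π +ℕ 1)
      reindexed : ∀ π → length π ≡ n → IsPerm π → summand (reverse (compl π)) ≈ pow s (occ Γ π) * pow t (ides π +ℕ 1)
      reindexed π |π|≡n perm = ≈-reflexive (cong₂ _*_
        (cong (pow s) (occ-ʳᶜ-reverse-compl Γ π perm))
        (cong (λ d → pow t (d +ℕ 1)) (ides-reverse-compl π k |π|≡n perm)))

    A-ides-reverse : ∀ t t⁻¹ → t * t⁻¹ ≈ 1# → A-ides (Γ ʳ) n s t ≈ pow t (n +ℕ 1) * A-ides Γ n s t⁻¹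
    A-ides-reverse t t⁻¹ tt⁻¹≈1 = ≈-trans (≈-sym (Σ-perms-reverse n summand))
      (≈-trans (Σ-perms-cong n reindexed) (sumOver-scale (perms n) (pow t (n +ℕ 1)) summand⁻¹))
      where
      summand summand⁻¹ : List ℕ → Carrier
      summand π = pow s (occ (Γ ʳ) π) * pow t (ides π +ℕ 1)
      summand⁻¹ π = pow s (occ Γ π) * pow t⁻¹ (ides π +ℕ 1)
      reindexed : ∀ π → length π ≡ n → IsPerm π → summand (reverse π) ≈ pow t (n +ℕ 1) * summand⁻¹ π
      reindexed π |π|≡n perm = ≈-trans
        (*-cong (≈-reflexive (cong (pow s) (occ-ʳ-reverse Γ π)))
                (pow-complementary tt⁻¹≈1 (ides π) (ides (reverse π)) (ides+ides-reverse π k |π|≡n perm)))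
        (*-CS.x∙yz≈y∙xz _ _ _)

    A-ides-compl : ∀ t t⁻¹ → t * t⁻¹ ≈ 1# → A-ides (Γ ᶜ) n s t ≈ pow t (n +ℕ 1) * A-ides Γ n s t⁻¹
    A-ides-compl t t⁻¹ tt⁻¹≈1 = ≈-trans (≈-sym (Σ-perms-compl n summand))
      (≈-trans (Σ-perms-cong n reindexed) (sumOver-scale (perms n) (pow t (n +ℕ 1)) summand⁻¹))
      where
      summand summand⁻¹ : List ℕ → Carrier
      summand π = pow s (occ (Γ ᶜ) π) * pow t (ides π +ℕ 1)
      summand⁻¹ π = pow s (occ Γ π) * pow t⁻¹ (ides π +ℕ 1)
      reindexed : ∀ π → length π ≡ n → IsPerm π → summand (compl π) ≈ pow t (n +ℕ 1) * summand⁻¹ π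
      reindexed π |π|≡n perm = ≈-trans
        (*-cong (≈-reflexive (cong (pow s) (occ-ᶜ-compl Γ π perm)))
                (pow-complementary tt⁻¹≈1 (ides π) (ides (compl π)) (ides+ides-compl π k |π|≡n perm)))
        (*-CS.x∙yz≈y∙xz _ _ _)

    P-ipk-compl : ∀ t → P-ipk (Γ ᶜ) n s t ≈ P-ipk Γ n s t
    P-ipk-compl t = ≈-trans (≈-sym (Σ-perms-compl n summand)) (Σ-perms-cong n reindexed)
      where
      summand : List ℕ → Carrier
      summand π = pow s (occ (Γ ᶜ) π) * pow t (ipk π +ℕ 1)
      reindexed : ∀ π → length π ≡ n → IsPerm π → summand (compl π) ≈ pow s (occ Γ π) * pow t (ipk π +ℕ 1)
      reindexed π _ perm = ≈-reflexive (cong₂ _*_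
        (cong (pow s) (occ-ᶜ-compl Γ π perm))
        (cong (λ d → pow t (d +ℕ 1)) (ipk-compl π perm)))

proposition2p7 : ∀ {c ℓ} (R : CommutativeRing c ℓ) (Γ : PermSet) (n : ℕ) → 1 ≤ n →
    let open CommutativeRing R
        open GF R
    in ∀ (s t t⁻¹ q q⁻¹ : Carrier) → t * t⁻¹ ≈ 1# → q * q⁻¹ ≈ 1# →
      (A-ides-imaj (Γ ʳ) n s t q ≈ pow t (n +ℕ 1) * pow q (n C 2) * A-ides-imaj Γ n s t⁻¹ q⁻¹)
      × (A-ides-imaj (Γ ʳᶜ) n s t q ≈ A-ides-icomaj Γ n s t q)
      × (A-ides (Γ ʳᶜ) n s t ≈ A-ides Γ n s t)
      × (A-ides (Γ ʳ) n s t ≈ A-ides (Γ ᶜ) n s t)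
      × (A-ides (Γ ᶜ) n s t ≈ pow t (n +ℕ 1) * A-ides Γ n s t⁻¹)
      × (P-ipk (Γ ᶜ) n s t ≈ P-ipk Γ n s t)
proposition2p7 R Γ (suc k) (s≤s z≤n) s t t⁻¹ q q⁻¹ tt⁻¹≈1 qq⁻¹≈1 =
    A-ides-imaj-reverse R Γ k s t t⁻¹ q q⁻¹ tt⁻¹≈1 qq⁻¹≈1
  , A-ides-imaj-reverse-compl R Γ k s t q
  , A-ides-reverse-compl R Γ k s t
  , ≈-trans (A-ides-reverse R Γ k s t t⁻¹ tt⁻¹≈1) (≈-sym (A-ides-compl R Γ k s t t⁻¹ tt⁻¹≈1))
  , A-ides-compl R Γ k s t t⁻¹ tt⁻¹≈1
  , P-ipk-compl R Γ k s t
  where open CommutativeRing R using () renaming (trans to ≈-trans; sym to ≈-sym)
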